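{- For $k\in\mathbb{N}$, $0\le\ell\le 2k-1$ integer, and $\tau=u+iv\in\mathbb{H}$, \[ R_{2-2k}^{k-1}\tau^\ell = (-v)^{1-k}\sum_{j=0}^{\min\{k-1,\ell\}}\binom{\ell}{j}\frac{(2k-2-j)!}{(k-1-j)!}(-2)^j\sum_{\substack{\alpha = 0 \\ \ell-\alpha \text{ even }}}^{\ell-j}\binom{\ell-j}{\alpha}u^{\alpha}(iv)^{\ell-\alpha} + i\,\delta_{\ell=2k-1}(-1)^{k-1}2^{2k-2}(k-1)!\,v^k. \]
   Context: $R_\kappa=2i\frac{\partial}{\partial\tau}+\kappa v^{ -1}$ (the Maass raising operator, with $\frac{\partial}{\partial\tau}=\frac12(\frac{\partial}{\partial u}-i\frac{\partial}{\partial v})$), and $R_{2-2k}^{k-1}=R_{ -2}\circ\cdots\circ R_{2-2k}$ (the identity if $k=1$). $\delta$ is the Kronecker delta. -}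

module Defs where

open import Data.Nat as ℕ using (ℕ; zero; suc; _!; _⊓_; _%_; _≡ᵇ_)
open import Data.Nat.Properties using (_!≢0)
open import Data.Nat.DivMod using (_/_)
open import Data.Nat.Combinatorics using (_C_)
open import Data.Integer as ℤ using (ℤ; +_; -_)
open import Data.List using (List; upTo; foldr)
open import Data.Bool using (Bool; true; false; if_then_else_)
open import Relation.Binary.PropositionalEquality using (_≡_)
open import Relation.Nullary using (yes; no)

-- Gaussian integers ℤ[i] (all coefficients occurring are in ℤ[i])

infix 5 _+i_
record ℤ[i] : Set where
  constructor _+i_
  field
    re : ℤ
    im : ℤ
open ℤ[i] public

infixl 6 _⊕_
infixl 7 _⊗_
infixr 5 _·_
infixl 4 _⊞_

_⊕_ : ℤ[i] → ℤ[i] → ℤ[i]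
(a +i b) ⊕ (c +i d) = (a ℤ.+ c) +i (b ℤ.+ d)

_⊗_ : ℤ[i] → ℤ[i] → ℤ[i]
(a +i b) ⊗ (c +i d) = (a ℤ.* c ℤ.- b ℤ.* d) +i (a ℤ.* d ℤ.+ b ℤ.* c)

𝟘 𝟙 𝕚 : ℤ[i]
𝟘 = + 0 +i + 0
𝟙 = + 1 +i + 0
𝕚 = + 0 +i + 1

ι : ℤ → ℤ[i]
ι z = z +i + 0

_^ᶜ_ : ℤ[i] → ℕ → ℤ[i]
z ^ᶜ zero  = 𝟙
z ^ᶜ suc n = z ⊗ (z ^ᶜ n)

-- Functions on ℍ of the form  Σ c_{a,b} u^a v^b  (a ∈ ℕ, b ∈ ℤ),
-- τ = u + i v, represented by their coefficient families:
-- f a b = coefficient of u^a v^b.  (Every function in the lemma,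
-- and their derivatives, are of this form.)

Fn : Set
Fn = ℕ → ℤ → ℤ[i]

_≋_ : Fn → Fn → Set
f ≋ g = ∀ a b → f a b ≡ g a b

mono : ℤ[i] → ℕ → ℤ → Fn
mono c a b a′ b′ with a ℕ.≟ a′ | b ℤ.≟ b′
... | yes _ | yes _ = c
... | _ | _ = 𝟘

zeroFn : Fn
zeroFn _ _ = 𝟘

_⊞_ : Fn → Fn → Fn
(f ⊞ g) a b = f a b ⊕ g a b

_·_ : ℤ[i] → Fn → Fn
(c · f) a b = c ⊗ f a b

Σ : {A : Set} → List A → (A → Fn) → Fn
Σ xs F = foldr (λ x acc → F x ⊞ acc) zeroFn xs

Σto : ℕ → (ℕ → Fn) → Fn
Σto n F = Σ (upTo (suc n)) F

-- ∂/∂u (u^a v^b) = a u^{a-1} v^b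
∂u : Fn → Fn
∂u f a b = ι (+ suc a) ⊗ f (suc a) b

-- ∂/∂v (u^a v^b) = b u^a v^{b-1}
∂v : Fn → Fn
∂v f a b = ι (b ℤ.+ + 1) ⊗ f a (b ℤ.+ + 1)

v⁻¹· : Fn → Fn
v⁻¹· f a b = f a (b ℤ.+ + 1)

-- ∂/∂τ = ½(∂/∂u − i ∂/∂v); so  2i ∂/∂τ = i ∂/∂u + ∂/∂v
-- Maass raising operator R_κ = 2i ∂/∂τ + κ v^{-1}
R : ℤ → Fn → Fn
R κ f = ((𝕚 · ∂u f) ⊞ ∂v f) ⊞ (ι κ · v⁻¹· f)

Riter : ℕ → ℤ → Fn → Fn
Riter zero    κ f = f
Riter (suc m) κ f = Riter m (κ ℤ.+ + 2) (R κ f)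

-- R_{2-2k}^{k-1} = R_{-2} ∘ ⋯ ∘ R_{2-2k}
R^[k-1] : ℕ → Fn → Fn
R^[k-1] k = Riter (k ℕ.∸ 1) (+ 2 ℤ.- + (2 ℕ.* k))

τ^ : ℕ → Fn
τ^ ℓ = Σto ℓ (λ α → ι (+ (ℓ C α)) ⊗ (𝕚 ^ᶜ (ℓ ℕ.∸ α)) · mono 𝟙 α (+ (ℓ ℕ.∸ α)))

even : ℕ → Bool
even n = (n % 2) ≡ᵇ 0

-- (-v)^{1-k} · u^α (iv)^{ℓ-α}  =  (-1)^{k-1} i^{ℓ-α} · u^α v^{ℓ-α+1-k}
term : ℕ → ℕ → ℕ → Fn
term k ℓ α =
  ((ι (- + 1) ^ᶜ (k ℕ.∸ 1)) ⊗ (𝕚 ^ᶜ (ℓ ℕ.∸ α)))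
    · mono 𝟙 α (+ (ℓ ℕ.∸ α) ℤ.+ + 1 ℤ.- + k)

ratio : ℕ → ℕ → ℕ
ratio k j = _/_ (((2 ℕ.* k) ℕ.∸ 2 ℕ.∸ j) !) ((k ℕ.∸ 1 ℕ.∸ j) !) {{(k ℕ.∸ 1 ℕ.∸ j) !≢0}}

rhs : ℕ → ℕ → Fn
rhs k ℓ =
  Σto ((k ℕ.∸ 1) ⊓ ℓ) (λ j →
    (ι (+ (ℓ C j)) ⊗ ι (+ ratio k j) ⊗ (ι (- + 2) ^ᶜ j)) ·
      Σto (ℓ ℕ.∸ j) (λ α →
        if even (ℓ ℕ.∸ α)
          then ι (+ ((ℓ ℕ.∸ j) C α)) · term k ℓ α
          else zeroFn))
  ⊞ (if ℓ ≡ᵇ ((2 ℕ.* k) ℕ.∸ 1)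
       then (𝕚 ⊗ (ι (- + 1) ^ᶜ (k ℕ.∸ 1)) ⊗ ι (+ (2 ℕ.^ ((2 ℕ.* k) ℕ.∸ 2)))
              ⊗ ι (+ ((k ℕ.∸ 1) !))) · mono 𝟙 0 (+ k)
       else zeroFn)

-- All functions that occur are finite sums of monomials u^a v^b of one total degree w, so each is
-- determined by its u-profile a ↦ (coefficient of u^a v^(w-a)); R_κ lowers the degree by one and
-- acts on u-profiles.  For holomorphic f, R_κ (v^s f) = (s + κ) v^(s-1) f + v^s (2i ∂τ f), and
-- induction on m gives the expansion
--   R^m_κ (v^s f) = Σ_i C(m,i) (s+κ+i)(s+κ+i+1)⋯(s+κ+m-1) v^(s-m+i) (2i ∂τ)^i f.
-- For f = τ^ℓ, s = 0, κ = 2-2k, m = k-1 the rising factorials are signed falling factorials, and the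
-- coefficient of u^a becomes (-1)^(k-1) i^(ℓ-a) Σ_j C(ℓ,j) (2k-2-j)!/(k-1-j)! (-2)^j C(ℓ-j,a), which
-- is the stated double sum when ℓ - a is even.  When ℓ - a = 2p+1 is odd it equals
-- (-1)^(k-1) i^(ℓ-a) C(ℓ,a) (k-1)! G(2p+1) with G(m) = Σ_j C(m,j) (-2)^j C(2k-2-j, k-1), and two
-- Pascal-type recursions give G(2p+1) = C(p,k-1) (-4)^(k-1).  This vanishes unless p = k-1, that is
-- ℓ = 2k-1 and a = 0, where it is the correction term i (-1)^(k-1) 2^(2k-2) (k-1)! v^k.

module Submission where

open import Defs

open import Algebra.Bundles using (CommutativeRing)
open import Algebra.Structures using (IsCommutativeRing)
open import Data.Bool using (true; false; if_then_else_)
open import Data.Bool.Properties using (T-≡)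
open import Data.Empty using (⊥; ⊥-elim)
open import Data.Integer as ℤ using (ℤ; +_; -_)
import Data.Integer.Properties as ℤP
open import Data.Integer.Tactic.RingSolver renaming (solve-∀ to ℤ-solve-∀)
open import Data.List using (applyUpTo)
open import Data.Maybe using (Maybe; just; nothing)
open import Data.Nat using (ℕ; zero; suc; _+_; _*_; _∸_; _^_; _≤_; _<_; z≤n; s≤s; _!; _⊓_; _≡ᵇ_)
open import Data.Nat.Combinatorics using (_C_; nCk+nC[k+1]≡[n+1]C[k+1]; k>n⇒nCk≡0; nCk≡nC[n∸k]; nC1≡n; nCn≡1)
open import Data.Nat.Combinatorics.Base using (_P′_)
open import Data.Nat.Combinatorics.Specification using (nP′k≡n!/[n∸k]!)
open import Data.Nat.DivMod using (_/_; /-congˡ; /-congʳ)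
open import Data.Nat.Properties
open import Data.Nat.Tactic.RingSolver renaming (solve-∀ to ℕ-solve-∀)
open import Data.Product using (∃; _,_)
open import Function using (id; _∘_; _⇔_; mk⇔; Equivalence)
open import Level using (0ℓ)
open import Relation.Binary.Bundles using (Setoid)
open import Relation.Binary.Definitions using (tri<; tri≈; tri>)
open import Relation.Binary.PropositionalEquality
import Relation.Binary.Reasoning.Setoid as SetoidReasoning
open import Relation.Nullary using (Dec; yes; no)
open import Tactic.RingSolver using (solve-∀)
import Tactic.RingSolver.Core.AlmostCommutativeRing as ACR

⊖_ : ℤ[i] → ℤ[i]
⊖ (a +i b) = (- a) +i (- b)

private
  componentwise : ∀ {a b c d} → a ≡ c → b ≡ d → (a +i b) ≡ (c +i d)
  componentwise = cong₂ _+i_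

⊕-assoc : ∀ x y z → (x ⊕ y) ⊕ z ≡ x ⊕ (y ⊕ z)
⊕-assoc (a +i b) (c +i d) (e +i f) = componentwise (ℤP.+-assoc a c e) (ℤP.+-assoc b d f)

⊕-comm : ∀ x y → x ⊕ y ≡ y ⊕ x
⊕-comm (a +i b) (c +i d) = componentwise (ℤP.+-comm a c) (ℤP.+-comm b d)

⊕-identityˡ : ∀ x → 𝟘 ⊕ x ≡ x
⊕-identityˡ (a +i b) = componentwise (ℤP.+-identityˡ a) (ℤP.+-identityˡ b)

⊕-identityʳ : ∀ x → x ⊕ 𝟘 ≡ x
⊕-identityʳ (a +i b) = componentwise (ℤP.+-identityʳ a) (ℤP.+-identityʳ b)

⊖-inverseˡ : ∀ x → ⊖ x ⊕ x ≡ 𝟘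
⊖-inverseˡ (a +i b) = componentwise (ℤP.+-inverseˡ a) (ℤP.+-inverseˡ b)

⊖-inverseʳ : ∀ x → x ⊕ ⊖ x ≡ 𝟘
⊖-inverseʳ (a +i b) = componentwise (ℤP.+-inverseʳ a) (ℤP.+-inverseʳ b)

⊗-assoc : ∀ x y z → (x ⊗ y) ⊗ z ≡ x ⊗ (y ⊗ z)
⊗-assoc (a +i b) (c +i d) (e +i f) = componentwise (re-assoc a b c d e f) (im-assoc a b c d e f)
  where
  re-assoc : ∀ a b c d e f → (a ℤ.* c ℤ.- b ℤ.* d) ℤ.* e ℤ.- (a ℤ.* d ℤ.+ b ℤ.* c) ℤ.* f ≡
                             a ℤ.* (c ℤ.* e ℤ.- d ℤ.* f) ℤ.- b ℤ.* (c ℤ.* f ℤ.+ d ℤ.* e)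
  re-assoc = ℤ-solve-∀
  im-assoc : ∀ a b c d e f → (a ℤ.* c ℤ.- b ℤ.* d) ℤ.* f ℤ.+ (a ℤ.* d ℤ.+ b ℤ.* c) ℤ.* e ≡
                             a ℤ.* (c ℤ.* f ℤ.+ d ℤ.* e) ℤ.+ b ℤ.* (c ℤ.* e ℤ.- d ℤ.* f)
  im-assoc = ℤ-solve-∀

⊗-comm : ∀ x y → x ⊗ y ≡ y ⊗ x
⊗-comm (a +i b) (c +i d) = componentwise (re-comm a b c d) (im-comm a b c d)
  where
  re-comm : ∀ a b c d → a ℤ.* c ℤ.- b ℤ.* d ≡ c ℤ.* a ℤ.- d ℤ.* b
  re-comm = ℤ-solve-∀
  im-comm : ∀ a b c d → a ℤ.* d ℤ.+ b ℤ.* c ≡ c ℤ.* b ℤ.+ d ℤ.* a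
  im-comm = ℤ-solve-∀

⊗-identityˡ : ∀ x → 𝟙 ⊗ x ≡ x
⊗-identityˡ (a +i b) = componentwise (re-id a b) (im-id a b)
  where
  re-id : ∀ a b → + 1 ℤ.* a ℤ.- + 0 ℤ.* b ≡ a
  re-id = ℤ-solve-∀
  im-id : ∀ a b → + 1 ℤ.* b ℤ.+ + 0 ℤ.* a ≡ b
  im-id = ℤ-solve-∀

⊗-identityʳ : ∀ x → x ⊗ 𝟙 ≡ x
⊗-identityʳ x = trans (⊗-comm x 𝟙) (⊗-identityˡ x)

⊗-distribˡ-⊕ : ∀ x y z → x ⊗ (y ⊕ z) ≡ x ⊗ y ⊕ x ⊗ z
⊗-distribˡ-⊕ (a +i b) (c +i d) (e +i f) = componentwise (re-distrib a b c d e f) (im-distrib a b c d e f)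
  where
  re-distrib : ∀ a b c d e f → a ℤ.* (c ℤ.+ e) ℤ.- b ℤ.* (d ℤ.+ f) ≡ (a ℤ.* c ℤ.- b ℤ.* d) ℤ.+ (a ℤ.* e ℤ.- b ℤ.* f)
  re-distrib = ℤ-solve-∀
  im-distrib : ∀ a b c d e f → a ℤ.* (d ℤ.+ f) ℤ.+ b ℤ.* (c ℤ.+ e) ≡ (a ℤ.* d ℤ.+ b ℤ.* c) ℤ.+ (a ℤ.* f ℤ.+ b ℤ.* e)
  im-distrib = ℤ-solve-∀

⊗-distribʳ-⊕ : ∀ x y z → (y ⊕ z) ⊗ x ≡ y ⊗ x ⊕ z ⊗ x
⊗-distribʳ-⊕ x y z = begin
  (y ⊕ z) ⊗ x     ≡⟨ ⊗-comm (y ⊕ z) x ⟩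
  x ⊗ (y ⊕ z)     ≡⟨ ⊗-distribˡ-⊕ x y z ⟩
  x ⊗ y ⊕ x ⊗ z   ≡⟨ cong₂ _⊕_ (⊗-comm x y) (⊗-comm x z) ⟩
  y ⊗ x ⊕ z ⊗ x   ∎
  where open ≡-Reasoning

ℤ[i]-isCommutativeRing : IsCommutativeRing _≡_ _⊕_ _⊗_ ⊖_ 𝟘 𝟙
ℤ[i]-isCommutativeRing = record
  { isRing = record
    { +-isAbelianGroup = record
      { isGroup = record
        { isMonoid = record
          { isSemigroup = record
            { isMagma = record { isEquivalence = isEquivalence ; ∙-cong = cong₂ _⊕_ }
            ; assoc = ⊕-assoc }
          ; identity = ⊕-identityˡ , ⊕-identityʳ }
        ; inverse = ⊖-inverseˡ , ⊖-inverseʳ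
        ; ⁻¹-cong = cong ⊖_ }
      ; comm = ⊕-comm }
    ; *-cong = cong₂ _⊗_
    ; *-assoc = ⊗-assoc
    ; *-identity = ⊗-identityˡ , ⊗-identityʳ
    ; distrib = ⊗-distribˡ-⊕ , ⊗-distribʳ-⊕ }
  ; *-comm = ⊗-comm }

ℤ[i]-commutativeRing : CommutativeRing 0ℓ 0ℓ
ℤ[i]-commutativeRing = record { isCommutativeRing = ℤ[i]-isCommutativeRing }

ℤ[i]-ring : ACR.AlmostCommutativeRing 0ℓ 0ℓ
ℤ[i]-ring = ACR.fromCommutativeRing ℤ[i]-commutativeRing 𝟘≟
  where
  𝟘≟ : ∀ x → Maybe (𝟘 ≡ x)
  𝟘≟ (+ 0 +i + 0) = just refl
  𝟘≟ _            = nothing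

fromℕ : ℕ → ℤ[i]
fromℕ n = ι (+ n)

ι-* : ∀ x y → ι (x ℤ.* y) ≡ ι x ⊗ ι y
ι-* x y = componentwise (sym (ℤP.+-identityʳ (x ℤ.* y))) (trans (sym (ℤP.*-zeroʳ x)) (sym (ℤP.+-identityʳ _)))

fromℕ-* : ∀ m n → fromℕ (m * n) ≡ fromℕ m ⊗ fromℕ n
fromℕ-* m n = trans (cong ι (ℤP.pos-* m n)) (ι-* (+ m) (+ n))

^ᶜ-+ : ∀ z m n → z ^ᶜ (m + n) ≡ z ^ᶜ m ⊗ z ^ᶜ n
^ᶜ-+ z zero    n = sym (⊗-identityˡ _)
^ᶜ-+ z (suc m) n = trans (cong (z ⊗_) (^ᶜ-+ z m n)) (sym (⊗-assoc z _ _))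

^ᶜ-distribʳ-⊗ : ∀ z w n → (z ⊗ w) ^ᶜ n ≡ z ^ᶜ n ⊗ w ^ᶜ n
^ᶜ-distribʳ-⊗ z w zero    = sym (⊗-identityˡ 𝟙)
^ᶜ-distribʳ-⊗ z w (suc n) = trans (cong ((z ⊗ w) ⊗_) (^ᶜ-distribʳ-⊗ z w n)) (interchange z w _ _)
  where
  interchange : ∀ z w x y → (z ⊗ w) ⊗ (x ⊗ y) ≡ (z ⊗ x) ⊗ (w ⊗ y)
  interchange = solve-∀ ℤ[i]-ring

fromℕ-^ : ∀ m n → fromℕ (m ^ n) ≡ fromℕ m ^ᶜ n
fromℕ-^ m zero    = refl
fromℕ-^ m (suc n) = trans (fromℕ-* m (m ^ n)) (cong (fromℕ m ⊗_) (fromℕ-^ m n))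

∑ : ℕ → (ℕ → ℤ[i]) → ℤ[i]
∑ zero    f = 𝟘
∑ (suc n) f = f 0 ⊕ ∑ n (f ∘ suc)

syntax ∑ n (λ j → e) = ∑[ j < n ] e

∑-cong : ∀ n {f g : ℕ → ℤ[i]} → (∀ j → j < n → f j ≡ g j) → ∑ n f ≡ ∑ n g
∑-cong zero    eq = refl
∑-cong (suc n) eq = cong₂ _⊕_ (eq 0 (s≤s z≤n)) (∑-cong n (λ j j<n → eq (suc j) (s≤s j<n)))

∑-zero : ∀ n {f : ℕ → ℤ[i]} → (∀ j → j < n → f j ≡ 𝟘) → ∑ n f ≡ 𝟘
∑-zero zero    eq = refl
∑-zero (suc n) eq = trans (cong₂ _⊕_ (eq 0 (s≤s z≤n)) (∑-zero n (λ j j<n → eq (suc j) (s≤s j<n)))) (⊕-identityˡ 𝟘)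

∑-⊕ : ∀ n (f g : ℕ → ℤ[i]) → ∑[ j < n ] (f j ⊕ g j) ≡ ∑ n f ⊕ ∑ n g
∑-⊕ zero    f g = sym (⊕-identityˡ 𝟘)
∑-⊕ (suc n) f g = trans (cong (f 0 ⊕ g 0 ⊕_) (∑-⊕ n (f ∘ suc) (g ∘ suc))) (medial (f 0) (g 0) _ _)
  where
  medial : ∀ a b c d → (a ⊕ b) ⊕ (c ⊕ d) ≡ (a ⊕ c) ⊕ (b ⊕ d)
  medial = solve-∀ ℤ[i]-ring

⊗-distribˡ-∑ : ∀ n c (f : ℕ → ℤ[i]) → c ⊗ ∑ n f ≡ ∑[ j < n ] (c ⊗ f j)
⊗-distribˡ-∑ zero    c f = ⊗-zeroʳ c
  where
  ⊗-zeroʳ : ∀ c → c ⊗ 𝟘 ≡ 𝟘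
  ⊗-zeroʳ = solve-∀ ℤ[i]-ring
⊗-distribˡ-∑ (suc n) c f = trans (⊗-distribˡ-⊕ c (f 0) _) (cong (c ⊗ f 0 ⊕_) (⊗-distribˡ-∑ n c (f ∘ suc)))

∑-init-last : ∀ n (f : ℕ → ℤ[i]) → ∑ (suc n) f ≡ ∑ n f ⊕ f n
∑-init-last zero    f = trans (⊕-identityʳ (f 0)) (sym (⊕-identityˡ (f 0)))
∑-init-last (suc n) f = trans (cong (f 0 ⊕_) (∑-init-last n (f ∘ suc))) (sym (⊕-assoc (f 0) _ _))

∑-truncate : ∀ n N (f : ℕ → ℤ[i]) → n ≤ N → (∀ j → n ≤ j → j < N → f j ≡ 𝟘) → ∑ N f ≡ ∑ n f
∑-truncate zero    N       f _         vanish = ∑-zero N (λ j j<N → vanish j z≤n j<N)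
∑-truncate (suc n) (suc N) f (s≤s n≤N) vanish =
  cong (f 0 ⊕_) (∑-truncate n N (f ∘ suc) n≤N (λ j n≤j j<N → vanish (suc j) (s≤s n≤j) (s≤s j<N)))

∑-pascal : ∀ n (f g h : ℕ → ℤ[i]) → h 0 ≡ f 0 → (∀ i → h (suc i) ≡ f (suc i) ⊕ g i) → f (suc n) ≡ 𝟘 →
           ∑ (suc n) f ⊕ ∑ (suc n) g ≡ ∑ (suc (suc n)) h
∑-pascal n f g h h₀ hₛ f-top = begin
  ∑ (suc n) f ⊕ ∑ (suc n) g                           ≡⟨ cong (_⊕ ∑ (suc n) g) (sym f-extend) ⟩
  (f 0 ⊕ ∑ (suc n) (f ∘ suc)) ⊕ ∑ (suc n) g           ≡⟨ ⊕-assoc (f 0) (∑ (suc n) (f ∘ suc)) (∑ (suc n) g) ⟩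
  f 0 ⊕ (∑ (suc n) (f ∘ suc) ⊕ ∑ (suc n) g)           ≡⟨ cong (f 0 ⊕_) (sym (∑-⊕ (suc n) (f ∘ suc) g)) ⟩
  f 0 ⊕ ∑[ i < suc n ] (f (suc i) ⊕ g i)              ≡⟨ cong₂ _⊕_ (sym h₀) (∑-cong (suc n) (λ i _ → sym (hₛ i))) ⟩
  h 0 ⊕ ∑ (suc n) (h ∘ suc)                           ∎
  where
  open ≡-Reasoning
  f-extend : ∑ (suc (suc n)) f ≡ ∑ (suc n) f
  f-extend = trans (∑-init-last (suc n) f) (trans (cong (∑ (suc n) f ⊕_) f-top) (⊕-identityʳ (∑ (suc n) f)))

⟦_⟧ : {A : Set} → Dec A → ℤ[i]
⟦ yes _ ⟧ = 𝟙
⟦ no _  ⟧ = 𝟘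

⟦⟧-cong : {A B : Set} → A ⇔ B → (a? : Dec A) (b? : Dec B) → ⟦ a? ⟧ ≡ ⟦ b? ⟧
⟦⟧-cong A⇔B (yes _) (yes _) = refl
⟦⟧-cong A⇔B (no _)  (no _)  = refl
⟦⟧-cong A⇔B (yes a) (no ¬b) = ⊥-elim (¬b (Equivalence.to A⇔B a))
⟦⟧-cong A⇔B (no ¬a) (yes b) = ⊥-elim (¬a (Equivalence.from A⇔B b))

⟦≟⟧-cong : ∀ {x y x′ y′} → x ℤ.- y ≡ x′ ℤ.- y′ → ⟦ x ℤ.≟ y ⟧ ≡ ⟦ x′ ℤ.≟ y′ ⟧
⟦≟⟧-cong {x} {y} {x′} {y′} eq = ⟦⟧-cong (mk⇔ to from) (x ℤ.≟ y) (x′ ℤ.≟ y′)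
  where
  to : x ≡ y → x′ ≡ y′
  to x≡y = ℤP.i-j≡0⇒i≡j x′ y′ (trans (sym eq) (ℤP.i≡j⇒i-j≡0 x≡y))
  from : x′ ≡ y′ → x ≡ y
  from x′≡y′ = ℤP.i-j≡0⇒i≡j x y (trans eq (ℤP.i≡j⇒i-j≡0 x′≡y′))

⟦⟧-⊗-cong : {A : Set} (a? : Dec A) {x y : ℤ[i]} → (A → x ≡ y) → ⟦ a? ⟧ ⊗ x ≡ ⟦ a? ⟧ ⊗ y
⟦⟧-⊗-cong (yes a) eq = cong (𝟙 ⊗_) (eq a)
⟦⟧-⊗-cong (no _) {x} {y} eq = trans (𝟘-⊗ x) (sym (𝟘-⊗ y))
  where
  𝟘-⊗ : ∀ x → 𝟘 ⊗ x ≡ 𝟘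
  𝟘-⊗ = solve-∀ ℤ[i]-ring

∑-⟦≟⟧ : ∀ N a (g : ℕ → ℤ[i]) → (N ≤ a → g a ≡ 𝟘) → ∑[ α < N ] (⟦ α ≟ a ⟧ ⊗ g α) ≡ g a
∑-⟦≟⟧ zero    a       g outside = sym (outside z≤n)
∑-⟦≟⟧ (suc N) zero    g outside = trans (cong (𝟙 ⊗ g 0 ⊕_) (∑-zero N (λ j _ → 𝟘-⊗ (g (suc j))))) (picked (g 0))
  where
  𝟘-⊗ : ∀ x → 𝟘 ⊗ x ≡ 𝟘
  𝟘-⊗ = solve-∀ ℤ[i]-ring
  picked : ∀ x → 𝟙 ⊗ x ⊕ 𝟘 ≡ x
  picked = solve-∀ ℤ[i]-ring
∑-⟦≟⟧ (suc N) (suc a) g outside = begin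
  𝟘 ⊗ g 0 ⊕ ∑[ α < N ] (⟦ suc α ≟ suc a ⟧ ⊗ g (suc α))
    ≡⟨ cong (𝟘 ⊗ g 0 ⊕_) (∑-cong N (λ α _ → cong (_⊗ g (suc α)) (⟦⟧-cong (mk⇔ suc-injective (cong suc)) (suc α ≟ suc a) (α ≟ a)))) ⟩
  𝟘 ⊗ g 0 ⊕ ∑[ α < N ] (⟦ α ≟ a ⟧ ⊗ g (suc α))
    ≡⟨ cong (𝟘 ⊗ g 0 ⊕_) (∑-⟦≟⟧ N a (g ∘ suc) (outside ∘ s≤s)) ⟩
  𝟘 ⊗ g 0 ⊕ g (suc a)
    ≡⟨ skipped (g 0) (g (suc a)) ⟩
  g (suc a) ∎
  where
  open ≡-Reasoning
  skipped : ∀ x y → 𝟘 ⊗ x ⊕ y ≡ y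
  skipped = solve-∀ ℤ[i]-ring

[k+1]*[n+1]C[k+1]≡[n+1]*nCk : ∀ n k → suc k * (suc n C suc k) ≡ suc n * (n C k)
[k+1]*[n+1]C[k+1]≡[n+1]*nCk zero    zero    = refl
[k+1]*[n+1]C[k+1]≡[n+1]*nCk zero    (suc k) = *-zeroʳ (suc (suc k))
[k+1]*[n+1]C[k+1]≡[n+1]*nCk (suc n) zero    =
  trans (*-identityˡ _) (trans (nC1≡n (suc (suc n))) (sym (*-identityʳ (suc (suc n)))))
[k+1]*[n+1]C[k+1]≡[n+1]*nCk (suc n) (suc k) = begin
  suc (suc k) * (suc (suc n) C suc (suc k))         ≡⟨ cong (suc (suc k) *_) (sym (nCk+nC[k+1]≡[n+1]C[k+1] (suc n) (suc k))) ⟩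
  suc (suc k) * (x + y)                             ≡⟨ *-distribˡ-+ (suc (suc k)) x y ⟩
  x + suc k * x + suc (suc k) * y                   ≡⟨ +-assoc x (suc k * x) (suc (suc k) * y) ⟩
  x + (suc k * x + suc (suc k) * y)                 ≡⟨ cong (_+_ x) (cong₂ _+_ ([k+1]*[n+1]C[k+1]≡[n+1]*nCk n k) ([k+1]*[n+1]C[k+1]≡[n+1]*nCk n (suc k))) ⟩
  x + (suc n * (n C k) + suc n * (n C suc k))       ≡⟨ cong (_+_ x) (sym (*-distribˡ-+ (suc n) (n C k) (n C suc k))) ⟩
  x + suc n * (n C k + n C suc k)                   ≡⟨ cong (λ t → x + suc n * t) (nCk+nC[k+1]≡[n+1]C[k+1] n k) ⟩
  x + suc n * x                                     ∎
  where
  open ≡-Reasoning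
  x = suc n C suc k
  y = suc n C suc (suc k)

[n+1∸k]*[n+1]Ck≡[n+1]*nCk : ∀ n k → (suc n ∸ k) * (suc n C k) ≡ suc n * (n C k)
[n+1∸k]*[n+1]Ck≡[n+1]*nCk n k with k ≤? n
... | no k≰n = begin
  (suc n ∸ k) * (suc n C k)  ≡⟨ cong (_* (suc n C k)) (m≤n⇒m∸n≡0 (≰⇒> k≰n)) ⟩
  0                          ≡⟨ sym (*-zeroʳ (suc n)) ⟩
  suc n * 0                  ≡⟨ cong (suc n *_) (sym (k>n⇒nCk≡0 (≰⇒> k≰n))) ⟩
  suc n * (n C k)            ∎
  where open ≡-Reasoning
... | yes k≤n = begin
  (suc n ∸ k) * (suc n C k)                 ≡⟨ cong₂ _*_ (+-∸-assoc 1 k≤n) (nCk≡nC[n∸k] (m≤n⇒m≤1+n k≤n)) ⟩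
  suc (n ∸ k) * (suc n C (suc n ∸ k))       ≡⟨ cong (λ t → suc (n ∸ k) * (suc n C t)) (+-∸-assoc 1 k≤n) ⟩
  suc (n ∸ k) * (suc n C suc (n ∸ k))       ≡⟨ [k+1]*[n+1]C[k+1]≡[n+1]*nCk n (n ∸ k) ⟩
  suc n * (n C (n ∸ k))                     ≡⟨ cong (suc n *_) (sym (nCk≡nC[n∸k] k≤n)) ⟩
  suc n * (n C k)                           ∎
  where open ≡-Reasoning

[k+1]*nC[k+1]≡[n∸k]*nCk : ∀ n k → suc k * (n C suc k) ≡ (n ∸ k) * (n C k)
[k+1]*nC[k+1]≡[n∸k]*nCk zero    k = trans (*-zeroʳ (suc k)) (cong (_* (0 C k)) (sym (0∸n≡0 k)))
[k+1]*nC[k+1]≡[n∸k]*nCk (suc n) k =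
  trans ([k+1]*[n+1]C[k+1]≡[n+1]*nCk n k) (sym ([n+1∸k]*[n+1]Ck≡[n+1]*nCk n k))

nCk*k!≡nP′k : ∀ n k → (n C k) * k ! ≡ n P′ k
nCk*k!≡nP′k n zero    = refl
nCk*k!≡nP′k n (suc k) = begin
  (n C suc k) * (suc k * k !)    ≡⟨ regroup (n C suc k) (suc k) (k !) ⟩
  (suc k * (n C suc k)) * k !    ≡⟨ cong (_* k !) ([k+1]*nC[k+1]≡[n∸k]*nCk n k) ⟩
  ((n ∸ k) * (n C k)) * k !      ≡⟨ *-assoc (n ∸ k) (n C k) (k !) ⟩
  (n ∸ k) * ((n C k) * k !)      ≡⟨ cong ((n ∸ k) *_) (nCk*k!≡nP′k n k) ⟩
  (n ∸ k) * (n P′ k)               ∎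
  where
  open ≡-Reasoning
  regroup : ∀ x y z → x * (y * z) ≡ (y * x) * z
  regroup = ℕ-solve-∀

k>n⇒nP′k≡0 : ∀ {n k} → n < k → n P′ k ≡ 0
k>n⇒nP′k≡0 {n} {k} n<k = trans (sym (nCk*k!≡nP′k n k)) (cong (_* k !) (k>n⇒nCk≡0 n<k))

nP′[j+k]≡nP′j*[n∸j]P′k : ∀ n j k → n P′ (j + k) ≡ (n P′ j) * ((n ∸ j) P′ k)
nP′[j+k]≡nP′j*[n∸j]P′k n j zero    = trans (cong (n P′_) (+-identityʳ j)) (sym (*-identityʳ (n P′ j)))
nP′[j+k]≡nP′j*[n∸j]P′k n j (suc k) = begin
  n P′ (j + suc k)                          ≡⟨ cong (n P′_) (+-suc j k) ⟩
  (n ∸ (j + k)) * (n P′ (j + k))              ≡⟨ cong₂ _*_ (sym (∸-+-assoc n j k)) (nP′[j+k]≡nP′j*[n∸j]P′k n j k) ⟩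
  (n ∸ j ∸ k) * ((n P′ j) * ((n ∸ j) P′ k))     ≡⟨ x*[y*z]≡y*[x*z] (n ∸ j ∸ k) (n P′ j) ((n ∸ j) P′ k) ⟩
  (n P′ j) * ((n ∸ j ∸ k) * ((n ∸ j) P′ k))     ∎
  where
  open ≡-Reasoning
  x*[y*z]≡y*[x*z] : ∀ x y z → x * (y * z) ≡ y * (x * z)
  x*[y*z]≡y*[x*z] = ℕ-solve-∀

nCj*[n∸j]Ck≡nCk*[n∸k]Cj : ∀ n j k → (n C j) * ((n ∸ j) C k) ≡ (n C k) * ((n ∸ k) C j)
nCj*[n∸j]Ck≡nCk*[n∸k]Cj n j k = *-cancelʳ-≡ _ _ (j ! * k !) {{m*n≢0 (j !) (k !) {{j !≢0}} {{k !≢0}}}} (begin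
  (n C j) * ((n ∸ j) C k) * (j ! * k !)       ≡⟨ interchange (n C j) ((n ∸ j) C k) (j !) (k !) ⟩
  ((n C j) * j !) * (((n ∸ j) C k) * k !)     ≡⟨ cong₂ _*_ (nCk*k!≡nP′k n j) (nCk*k!≡nP′k (n ∸ j) k) ⟩
  (n P′ j) * ((n ∸ j) P′ k)                       ≡⟨ sym (nP′[j+k]≡nP′j*[n∸j]P′k n j k) ⟩
  n P′ (j + k)                                ≡⟨ cong (n P′_) (+-comm j k) ⟩
  n P′ (k + j)                                ≡⟨ nP′[j+k]≡nP′j*[n∸j]P′k n k j ⟩
  (n P′ k) * ((n ∸ k) P′ j)                       ≡⟨ sym (cong₂ _*_ (nCk*k!≡nP′k n k) (nCk*k!≡nP′k (n ∸ k) j)) ⟩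
  ((n C k) * k !) * (((n ∸ k) C j) * j !)     ≡⟨ interchange′ (n C k) ((n ∸ k) C j) (j !) (k !) ⟩
  (n C k) * ((n ∸ k) C j) * (j ! * k !)       ∎)
  where
  open ≡-Reasoning
  interchange : ∀ x y p q → x * y * (p * q) ≡ (x * p) * (y * q)
  interchange = ℕ-solve-∀
  interchange′ : ∀ x y p q → (x * q) * (y * p) ≡ x * y * (p * q)
  interchange′ = ℕ-solve-∀

pos-∸ : ∀ {n k} → k ≤ n → + n ℤ.- + k ≡ + (n ∸ k)
pos-∸ {n} {k} k≤n = trans (ℤP.m-n≡m⊖n n k) (ℤP.⊖-≥ k≤n)

ι[n-k]⊗nCk≡[n∸k]*nCk : ∀ n k → ι (+ n ℤ.- + k) ⊗ fromℕ (n C k) ≡ fromℕ ((n ∸ k) * (n C k))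
ι[n-k]⊗nCk≡[n∸k]*nCk n k with k ≤? n
... | yes k≤n = trans (cong (λ t → ι t ⊗ fromℕ (n C k)) (pos-∸ k≤n)) (sym (fromℕ-* (n ∸ k) (n C k)))
... | no k≰n rewrite k>n⇒nCk≡0 (≰⇒> k≰n) | *-zeroʳ (n ∸ k) = ⊗-zeroʳ (ι (+ n ℤ.- + k))
  where
  ⊗-zeroʳ : ∀ x → x ⊗ 𝟘 ≡ 𝟘
  ⊗-zeroʳ = solve-∀ ℤ[i]-ring

_↑_ : ℤ → ℕ → ℤ
x ↑ zero  = + 1
x ↑ suc r = (x ↑ r) ℤ.* (x ℤ.+ + r)

↑-suc : ∀ x r → x ↑ suc r ≡ x ℤ.* ((x ℤ.+ + 1) ↑ r)
↑-suc x zero    = first x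
  where
  first : ∀ x → + 1 ℤ.* (x ℤ.+ + 0) ≡ x ℤ.* + 1
  first = ℤ-solve-∀
↑-suc x (suc r) = begin
  (x ↑ suc r) ℤ.* (x ℤ.+ + suc r)                        ≡⟨ cong (ℤ._* (x ℤ.+ + suc r)) (↑-suc x r) ⟩
  x ℤ.* ((x ℤ.+ + 1) ↑ r) ℤ.* (x ℤ.+ (+ 1 ℤ.+ + r))       ≡⟨ regroup x ((x ℤ.+ + 1) ↑ r) (+ r) ⟩
  x ℤ.* (((x ℤ.+ + 1) ↑ r) ℤ.* (x ℤ.+ + 1 ℤ.+ + r))       ∎
  where
  open ≡-Reasoning
  regroup : ∀ x y r → x ℤ.* y ℤ.* (x ℤ.+ (+ 1 ℤ.+ r)) ≡ x ℤ.* (y ℤ.* (x ℤ.+ + 1 ℤ.+ r))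
  regroup = ℤ-solve-∀

ι-↑-neg : ∀ N r → ι ((- + N) ↑ r) ≡ ι (- + 1) ^ᶜ r ⊗ fromℕ (N P′ r)
ι-↑-neg N zero    = sym (⊗-identityˡ 𝟙)
ι-↑-neg N (suc r) with r ≤? N
... | yes r≤N = begin
  ι ((- + N) ↑ r ℤ.* (- + N ℤ.+ + r))                              ≡⟨ ι-* ((- + N) ↑ r) (- + N ℤ.+ + r) ⟩
  ι ((- + N) ↑ r) ⊗ ι (- + N ℤ.+ + r)                              ≡⟨ cong₂ _⊗_ (ι-↑-neg N r) (cong ι lowered) ⟩
  (ι (- + 1) ^ᶜ r ⊗ fromℕ (N P′ r)) ⊗ ι (- + (N ∸ r))              ≡⟨ regroup (ι (- + 1) ^ᶜ r) (fromℕ (N P′ r)) (fromℕ (N ∸ r)) ⟩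
  (ι (- + 1) ⊗ ι (- + 1) ^ᶜ r) ⊗ (fromℕ (N ∸ r) ⊗ fromℕ (N P′ r))  ≡⟨ cong (ι (- + 1) ^ᶜ suc r ⊗_) (sym (fromℕ-* (N ∸ r) (N P′ r))) ⟩
  ι (- + 1) ^ᶜ suc r ⊗ fromℕ ((N ∸ r) * (N P′ r))                  ∎
  where
  open ≡-Reasoning
  lowered : - + N ℤ.+ + r ≡ - + (N ∸ r)
  lowered = trans (ℤP.+-comm (- + N) (+ r)) (trans (ℤP.m-n≡m⊖n r N) (trans (ℤP.⊖-swap r N) (cong -_ (ℤP.⊖-≥ r≤N))))
  regroup : ∀ s F G → (s ⊗ F) ⊗ ⊖ G ≡ (ι (- + 1) ⊗ s) ⊗ (G ⊗ F)
  regroup = solve-∀ ℤ[i]-ring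
... | no r≰N = begin
  ι ((- + N) ↑ r ℤ.* (- + N ℤ.+ + r))                  ≡⟨ ι-* ((- + N) ↑ r) (- + N ℤ.+ + r) ⟩
  ι ((- + N) ↑ r) ⊗ ι (- + N ℤ.+ + r)                  ≡⟨ cong (_⊗ ι (- + N ℤ.+ + r)) (ι-↑-neg N r) ⟩
  (ι (- + 1) ^ᶜ r ⊗ fromℕ (N P′ r)) ⊗ ι (- + N ℤ.+ + r) ≡⟨ cong (λ t → (ι (- + 1) ^ᶜ r ⊗ fromℕ t) ⊗ ι (- + N ℤ.+ + r)) N<r⇒0 ⟩
  (ι (- + 1) ^ᶜ r ⊗ 𝟘) ⊗ ι (- + N ℤ.+ + r)              ≡⟨ vanish (ι (- + 1) ^ᶜ r) (ι (- + N ℤ.+ + r)) (ι (- + 1) ^ᶜ suc r) ⟩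
  ι (- + 1) ^ᶜ suc r ⊗ 𝟘                                ≡⟨ cong (λ t → ι (- + 1) ^ᶜ suc r ⊗ fromℕ t) (sym N<r⇒0′) ⟩
  ι (- + 1) ^ᶜ suc r ⊗ fromℕ ((N ∸ r) * (N P′ r))       ∎
  where
  open ≡-Reasoning
  N<r⇒0 : N P′ r ≡ 0
  N<r⇒0 = k>n⇒nP′k≡0 (≰⇒> r≰N)
  N<r⇒0′ : (N ∸ r) * (N P′ r) ≡ 0
  N<r⇒0′ = trans (cong ((N ∸ r) *_) N<r⇒0) (*-zeroʳ (N ∸ r))
  vanish : ∀ s x s′ → (s ⊗ 𝟘) ⊗ x ≡ s′ ⊗ 𝟘
  vanish = solve-∀ ℤ[i]-ring

-- Coefficient of v^(s-m+i) (2i ∂/∂τ)^i f in R^m_κ (v^s f) for holomorphic f, where c = s + κ.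
raisingCoeff : ℕ → ℤ → ℕ → ℤ
raisingCoeff m c i = + (m C i) ℤ.* ((c ℤ.+ + i) ↑ (m ∸ i))

raisingCoeff-zero : ∀ m c → raisingCoeff (suc m) c 0 ≡ c ℤ.* raisingCoeff m (c ℤ.+ + 1) 0
raisingCoeff-zero m c = begin
  + 1 ℤ.* ((c ℤ.+ + 0) ↑ suc m)                     ≡⟨ cong (λ t → + 1 ℤ.* (t ↑ suc m)) (ℤP.+-identityʳ c) ⟩
  + 1 ℤ.* (c ↑ suc m)                               ≡⟨ cong (+ 1 ℤ.*_) (↑-suc c m) ⟩
  + 1 ℤ.* (c ℤ.* ((c ℤ.+ + 1) ↑ m))                 ≡⟨ cong (λ t → + 1 ℤ.* (c ℤ.* (t ↑ m))) (sym (ℤP.+-identityʳ (c ℤ.+ + 1))) ⟩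
  + 1 ℤ.* (c ℤ.* ((c ℤ.+ + 1 ℤ.+ + 0) ↑ m))         ≡⟨ swap (c) ((c ℤ.+ + 1 ℤ.+ + 0) ↑ m) ⟩
  c ℤ.* (+ 1 ℤ.* ((c ℤ.+ + 1 ℤ.+ + 0) ↑ m))         ∎
  where
  open ≡-Reasoning
  swap : ∀ c x → + 1 ℤ.* (c ℤ.* x) ≡ c ℤ.* (+ 1 ℤ.* x)
  swap = ℤ-solve-∀

raisingCoeff-vanish : ∀ m c → raisingCoeff m c (suc m) ≡ + 0
raisingCoeff-vanish m c rewrite k>n⇒nCk≡0 (n<1+n m) = refl

[m+1]C[i+1]*[c+i+1]≡c*mC[i+1]+mCi*[c+m+1] : ∀ m i c →
  + (suc m C suc i) ℤ.* (c ℤ.+ + suc i) ≡ c ℤ.* + (m C suc i) ℤ.+ + (m C i) ℤ.* (c ℤ.+ + suc m)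
[m+1]C[i+1]*[c+i+1]≡c*mC[i+1]+mCi*[c+m+1] m i c = begin
  + S ℤ.* (c ℤ.+ + suc i)                           ≡⟨ split c (+ S) (+ i) ⟩
  c ℤ.* + S ℤ.+ + suc i ℤ.* + S
    ≡⟨ cong₂ (λ t u → c ℤ.* + t ℤ.+ u) (sym (nCk+nC[k+1]≡[n+1]C[k+1] m i)) (sym (ℤP.pos-* (suc i) S)) ⟩
  c ℤ.* (+ P ℤ.+ + Q) ℤ.+ + (suc i * S)             ≡⟨ cong (λ t → c ℤ.* (+ P ℤ.+ + Q) ℤ.+ + t) ([k+1]*[n+1]C[k+1]≡[n+1]*nCk m i) ⟩
  c ℤ.* (+ P ℤ.+ + Q) ℤ.+ + (suc m * P)             ≡⟨ cong (λ t → c ℤ.* (+ P ℤ.+ + Q) ℤ.+ t) (ℤP.pos-* (suc m) P) ⟩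
  c ℤ.* (+ P ℤ.+ + Q) ℤ.+ + suc m ℤ.* + P           ≡⟨ merge c (+ P) (+ Q) (+ suc m) ⟩
  c ℤ.* + Q ℤ.+ + P ℤ.* (c ℤ.+ + suc m)             ∎
  where
  open ≡-Reasoning
  S = suc m C suc i
  Q = m C suc i
  P = m C i
  split : ∀ c S i → S ℤ.* (c ℤ.+ (+ 1 ℤ.+ i)) ≡ c ℤ.* S ℤ.+ (+ 1 ℤ.+ i) ℤ.* S
  split = ℤ-solve-∀
  merge : ∀ c P Q M → c ℤ.* (P ℤ.+ Q) ℤ.+ M ℤ.* P ≡ c ℤ.* Q ℤ.+ P ℤ.* (c ℤ.+ M)
  merge = ℤ-solve-∀

raisingCoeff-pascal : ∀ m c i →
  raisingCoeff (suc m) c (suc i) ≡ c ℤ.* raisingCoeff m (c ℤ.+ + 1) (suc i) ℤ.+ raisingCoeff m (c ℤ.+ + 2) i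
raisingCoeff-pascal m c i with <-cmp i m
... | tri> _ _ m<i
  rewrite k>n⇒nCk≡0 (s≤s m<i) | k>n⇒nCk≡0 (m<n⇒m<1+n m<i) | k>n⇒nCk≡0 m<i =
  vanishing c ((c ℤ.+ + suc i) ↑ (m ∸ i)) ((c ℤ.+ + 1 ℤ.+ + suc i) ↑ (m ∸ suc i)) ((c ℤ.+ + 2 ℤ.+ + i) ↑ (m ∸ i))
  where
  vanishing : ∀ c x y z → + 0 ℤ.* x ≡ c ℤ.* (+ 0 ℤ.* y) ℤ.+ + 0 ℤ.* z
  vanishing = ℤ-solve-∀
... | tri≈ _ refl _
  rewrite nCn≡1 (suc i) | k>n⇒nCk≡0 (n<1+n i) | nCn≡1 i | n∸n≡0 i = diagonal c ((c ℤ.+ + 1 ℤ.+ + suc i) ↑ (i ∸ suc i))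
  where
  diagonal : ∀ c y → + 1 ℤ.* + 1 ≡ c ℤ.* (+ 0 ℤ.* y) ℤ.+ + 1 ℤ.* + 1
  diagonal = ℤ-solve-∀
... | tri< i<m _ _ with m≤n⇒∃[o]m+o≡n i<m
...   | r , refl = begin
  + S ℤ.* ((c ℤ.+ + suc i) ↑ (suc (i + r) ∸ i))
    ≡⟨ cong (λ t → + S ℤ.* ((c ℤ.+ + suc i) ↑ t)) [1+i+r]∸i≡1+r ⟩
  + S ℤ.* ((c ℤ.+ + suc i) ↑ suc r)
    ≡⟨ cong (+ S ℤ.*_) (↑-suc (c ℤ.+ + suc i) r) ⟩
  + S ℤ.* ((c ℤ.+ + suc i) ℤ.* ((c ℤ.+ + suc i ℤ.+ + 1) ↑ r))
    ≡⟨ cong (λ t → + S ℤ.* ((c ℤ.+ + suc i) ℤ.* (t ↑ r))) (shift c (+ i)) ⟩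
  + S ℤ.* ((c ℤ.+ + suc i) ℤ.* ρ)
    ≡⟨ sym (ℤP.*-assoc (+ S) (c ℤ.+ + suc i) ρ) ⟩
  + S ℤ.* (c ℤ.+ + suc i) ℤ.* ρ
    ≡⟨ cong (ℤ._* ρ) ([m+1]C[i+1]*[c+i+1]≡c*mC[i+1]+mCi*[c+m+1] (suc (i + r)) i c) ⟩
  (c ℤ.* + Q ℤ.+ + P ℤ.* (c ℤ.+ + suc (suc (i + r)))) ℤ.* ρ
    ≡⟨ distrib c (+ Q) (+ P) (+ i) (+ r) ρ ⟩
  c ℤ.* (+ Q ℤ.* ρ) ℤ.+ + P ℤ.* (ρ ℤ.* (c ℤ.+ + 2 ℤ.+ + i ℤ.+ + r))
    ≡⟨ cong₂ (λ t t′ → c ℤ.* (+ Q ℤ.* t) ℤ.+ + P ℤ.* t′)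
             (cong (_↑ r) (shift′ c (+ i))) (cong (_↑_ (c ℤ.+ + 2 ℤ.+ + i)) (sym [1+i+r]∸i≡1+r)) ⟩
  c ℤ.* (+ Q ℤ.* ((c ℤ.+ + 1 ℤ.+ + suc i) ↑ r)) ℤ.+ + P ℤ.* ((c ℤ.+ + 2 ℤ.+ + i) ↑ (suc (i + r) ∸ i))
    ≡⟨ cong (λ t → c ℤ.* (+ Q ℤ.* ((c ℤ.+ + 1 ℤ.+ + suc i) ↑ t)) ℤ.+ + P ℤ.* ((c ℤ.+ + 2 ℤ.+ + i) ↑ (suc (i + r) ∸ i)))
            (sym (m+n∸m≡n i r)) ⟩
  c ℤ.* (+ Q ℤ.* ((c ℤ.+ + 1 ℤ.+ + suc i) ↑ (i + r ∸ i))) ℤ.+ + P ℤ.* ((c ℤ.+ + 2 ℤ.+ + i) ↑ (suc (i + r) ∸ i))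
    ∎
  where
  open ≡-Reasoning
  S = suc (suc (i + r)) C suc i
  Q = suc (i + r) C suc i
  P = suc (i + r) C i
  ρ = (c ℤ.+ + 2 ℤ.+ + i) ↑ r
  [1+i+r]∸i≡1+r : suc (i + r) ∸ i ≡ suc r
  [1+i+r]∸i≡1+r = trans (cong (_∸ i) (sym (+-suc i r))) (m+n∸m≡n i (suc r))
  shift : ∀ c i → c ℤ.+ (+ 1 ℤ.+ i) ℤ.+ + 1 ≡ c ℤ.+ + 2 ℤ.+ i
  shift = ℤ-solve-∀
  shift′ : ∀ c i → c ℤ.+ + 2 ℤ.+ i ≡ c ℤ.+ + 1 ℤ.+ (+ 1 ℤ.+ i)
  shift′ = ℤ-solve-∀
  distrib : ∀ c Q P i r ρ → (c ℤ.* Q ℤ.+ P ℤ.* (c ℤ.+ (+ 2 ℤ.+ i ℤ.+ r))) ℤ.* ρ ≡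
                            c ℤ.* (Q ℤ.* ρ) ℤ.+ P ℤ.* (ρ ℤ.* (c ℤ.+ + 2 ℤ.+ i ℤ.+ r))
  distrib = ℤ-solve-∀

≋-setoid : Setoid 0ℓ 0ℓ
≋-setoid = record
  { Carrier       = Fn
  ; _≈_           = _≋_
  ; isEquivalence = record
    { refl  = λ _ _ → refl
    ; sym   = λ f≋g a b → sym (f≋g a b)
    ; trans = λ f≋g g≋h a b → trans (f≋g a b) (g≋h a b)
    }
  }

R-cong : ∀ κ {f g} → f ≋ g → R κ f ≋ R κ g
R-cong κ f≋g a b rewrite f≋g (suc a) b | f≋g a (b ℤ.+ + 1) = refl

R-⊞ : ∀ κ f g → R κ (f ⊞ g) ≋ (R κ f ⊞ R κ g)
R-⊞ κ f g a b = distrib 𝕚 (fromℕ (suc a)) (ι (b ℤ.+ + 1)) (ι κ) (f (suc a) b) (g (suc a) b) (f a (b ℤ.+ + 1)) (g a (b ℤ.+ + 1))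
  where
  distrib : ∀ i A B K f₁ g₁ f₀ g₀ →
    (i ⊗ (A ⊗ (f₁ ⊕ g₁)) ⊕ B ⊗ (f₀ ⊕ g₀)) ⊕ K ⊗ (f₀ ⊕ g₀) ≡
    ((i ⊗ (A ⊗ f₁) ⊕ B ⊗ f₀) ⊕ K ⊗ f₀) ⊕ ((i ⊗ (A ⊗ g₁) ⊕ B ⊗ g₀) ⊕ K ⊗ g₀)
  distrib = solve-∀ ℤ[i]-ring

R-· : ∀ κ c f → R κ (c · f) ≋ (c · R κ f)
R-· κ c f a b = scale 𝕚 (fromℕ (suc a)) (ι (b ℤ.+ + 1)) (ι κ) c (f (suc a) b) (f a (b ℤ.+ + 1))
  where
  scale : ∀ i A B K c f₁ f₀ →
    (i ⊗ (A ⊗ (c ⊗ f₁)) ⊕ B ⊗ (c ⊗ f₀)) ⊕ K ⊗ (c ⊗ f₀) ≡ c ⊗ ((i ⊗ (A ⊗ f₁) ⊕ B ⊗ f₀) ⊕ K ⊗ f₀)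
  scale = solve-∀ ℤ[i]-ring

Riter-cong : ∀ m κ {f g} → f ≋ g → Riter m κ f ≋ Riter m κ g
Riter-cong zero    κ f≋g = f≋g
Riter-cong (suc m) κ f≋g = Riter-cong m (κ ℤ.+ + 2) (R-cong κ f≋g)

Riter-⊞ : ∀ m κ f g → Riter m κ (f ⊞ g) ≋ (Riter m κ f ⊞ Riter m κ g)
Riter-⊞ zero    κ f g a b = refl
Riter-⊞ (suc m) κ f g a b =
  trans (Riter-cong m (κ ℤ.+ + 2) (R-⊞ κ f g) a b) (Riter-⊞ m (κ ℤ.+ + 2) (R κ f) (R κ g) a b)

Riter-· : ∀ m κ c f → Riter m κ (c · f) ≋ (c · Riter m κ f)
Riter-· zero    κ c f a b = refl
Riter-· (suc m) κ c f a b =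
  trans (Riter-cong m (κ ℤ.+ + 2) (R-· κ c f) a b) (Riter-· m (κ ℤ.+ + 2) c (R κ f) a b)

⊞-cong : ∀ {f f′ g g′} → f ≋ f′ → g ≋ g′ → (f ⊞ g) ≋ (f′ ⊞ g′)
⊞-cong f≋f′ g≋g′ a b = cong₂ _⊕_ (f≋f′ a b) (g≋g′ a b)

·-cong : ∀ c {f g} → f ≋ g → (c · f) ≋ (c · g)
·-cong c f≋g a b = cong (c ⊗_) (f≋g a b)

Profile : Set
Profile = ℕ → ℤ[i]

-- Σ_a g(a) u^a v^(w-a): the function of total degree w in (u, v) with u-profile g.
homogeneous : ℤ → Profile → Fn
homogeneous w g a b = ⟦ w ℤ.- + a ℤ.≟ b ⟧ ⊗ g a

homogeneous-cong : ∀ {w w′} {g h : Profile} → w ≡ w′ → (∀ a → g a ≡ h a) → homogeneous w g ≋ homogeneous w′ h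
homogeneous-cong {w} refl g≗h a b = cong (⟦ w ℤ.- + a ℤ.≟ b ⟧ ⊗_) (g≗h a)

·-homogeneous : ∀ c w g → (c · homogeneous w g) ≋ homogeneous w (λ a → c ⊗ g a)
·-homogeneous c w g a b = swap c ⟦ w ℤ.- + a ℤ.≟ b ⟧ (g a)
  where
  swap : ∀ c d x → c ⊗ (d ⊗ x) ≡ d ⊗ (c ⊗ x)
  swap = solve-∀ ℤ[i]-ring

⊞-homogeneous : ∀ w g h → (homogeneous w g ⊞ homogeneous w h) ≋ homogeneous w (λ a → g a ⊕ h a)
⊞-homogeneous w g h a b = sym (⊗-distribˡ-⊕ ⟦ w ℤ.- + a ℤ.≟ b ⟧ (g a) (h a))

zeroFn-homogeneous : ∀ w → zeroFn ≋ homogeneous w (λ _ → 𝟘)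
zeroFn-homogeneous w a b = sym (⊗-zeroʳ ⟦ w ℤ.- + a ℤ.≟ b ⟧)
  where
  ⊗-zeroʳ : ∀ c → c ⊗ 𝟘 ≡ 𝟘
  ⊗-zeroʳ = solve-∀ ℤ[i]-ring

mono-homogeneous : ∀ c α B → mono c α B ≋ homogeneous (+ α ℤ.+ B) (λ a → ⟦ α ≟ a ⟧ ⊗ c)
mono-homogeneous c α B a b = begin
  mono c α B a b                              ≡⟨ mono-apply ⟩
  ⟦ α ≟ a ⟧ ⊗ (⟦ B ℤ.≟ b ⟧ ⊗ c)               ≡⟨ ⟦⟧-⊗-cong (α ≟ a) (λ { refl → cong (_⊗ c) degree }) ⟩
  ⟦ α ≟ a ⟧ ⊗ (⟦ + α ℤ.+ B ℤ.- + a ℤ.≟ b ⟧ ⊗ c) ≡⟨ swap ⟦ α ≟ a ⟧ ⟦ + α ℤ.+ B ℤ.- + a ℤ.≟ b ⟧ c ⟩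
  ⟦ + α ℤ.+ B ℤ.- + a ℤ.≟ b ⟧ ⊗ (⟦ α ≟ a ⟧ ⊗ c) ∎
  where
  open ≡-Reasoning
  swap : ∀ c d x → c ⊗ (d ⊗ x) ≡ d ⊗ (c ⊗ x)
  swap = solve-∀ ℤ[i]-ring
  degree : ⟦ B ℤ.≟ b ⟧ ≡ ⟦ + a ℤ.+ B ℤ.- + a ℤ.≟ b ⟧
  degree = ⟦≟⟧-cong (shift (+ a) B b)
    where
    shift : ∀ x B b → B ℤ.- b ≡ x ℤ.+ B ℤ.- x ℤ.- b
    shift = ℤ-solve-∀
  mono-apply : mono c α B a b ≡ ⟦ α ≟ a ⟧ ⊗ (⟦ B ℤ.≟ b ⟧ ⊗ c)
  mono-apply with α ≟ a | B ℤ.≟ b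
  ... | yes _ | yes _ = sym (trans (⊗-identityˡ (𝟙 ⊗ c)) (⊗-identityˡ c))
  ... | yes _ | no _  = refl
  ... | no _  | _     = refl

·-mono-homogeneous : ∀ c α B w → + α ℤ.+ B ≡ w → (c · mono 𝟙 α B) ≋ homogeneous w (λ a → ⟦ α ≟ a ⟧ ⊗ c)
·-mono-homogeneous c α B w degree a b = begin
  c ⊗ mono 𝟙 α B a b                              ≡⟨ cong (c ⊗_) (mono-homogeneous 𝟙 α B a b) ⟩
  c ⊗ (⟦ + α ℤ.+ B ℤ.- + a ℤ.≟ b ⟧ ⊗ (⟦ α ≟ a ⟧ ⊗ 𝟙)) ≡⟨ regroup c ⟦ + α ℤ.+ B ℤ.- + a ℤ.≟ b ⟧ ⟦ α ≟ a ⟧ ⟩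
  ⟦ + α ℤ.+ B ℤ.- + a ℤ.≟ b ⟧ ⊗ (⟦ α ≟ a ⟧ ⊗ c)      ≡⟨ cong (λ w → ⟦ w ℤ.- + a ℤ.≟ b ⟧ ⊗ (⟦ α ≟ a ⟧ ⊗ c)) degree ⟩
  ⟦ w ℤ.- + a ℤ.≟ b ⟧ ⊗ (⟦ α ≟ a ⟧ ⊗ c)              ∎
  where
  open ≡-Reasoning
  regroup : ∀ c d e → c ⊗ (d ⊗ (e ⊗ 𝟙)) ≡ d ⊗ (e ⊗ c)
  regroup = solve-∀ ℤ[i]-ring

Σ-applyUpTo : ∀ (h : ℕ → ℕ) n (F : ℕ → Fn) a b → Σ (applyUpTo h n) F a b ≡ ∑[ j < n ] F (h j) a b
Σ-applyUpTo h zero    F a b = refl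
Σ-applyUpTo h (suc n) F a b = cong (F (h 0) a b ⊕_) (Σ-applyUpTo (h ∘ suc) n F a b)

Σto-homogeneous : ∀ N w (F : ℕ → Fn) (g : ℕ → Profile) → (∀ j → j ≤ N → F j ≋ homogeneous w (g j)) →
                  Σto N F ≋ homogeneous w (λ a → ∑[ j < suc N ] g j a)
Σto-homogeneous N w F g F≋g a b = begin
  Σto N F a b                                   ≡⟨ Σ-applyUpTo id (suc N) F a b ⟩
  ∑[ j < suc N ] F j a b                         ≡⟨ ∑-cong (suc N) (λ j j<1+N → F≋g j (≤-pred j<1+N) a b) ⟩
  ∑[ j < suc N ] (⟦ w ℤ.- + a ℤ.≟ b ⟧ ⊗ g j a)   ≡⟨ sym (⊗-distribˡ-∑ (suc N) ⟦ w ℤ.- + a ℤ.≟ b ⟧ (λ j → g j a)) ⟩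
  ⟦ w ℤ.- + a ℤ.≟ b ⟧ ⊗ ∑[ j < suc N ] g j a     ∎
  where open ≡-Reasoning

R-homogeneous : ∀ κ w g → R κ (homogeneous w g) ≋
  homogeneous (w ℤ.- + 1) (λ a → 𝕚 ⊗ (fromℕ (suc a) ⊗ g (suc a)) ⊕ ι (w ℤ.- + a ℤ.+ κ) ⊗ g a)
R-homogeneous κ w g a b = begin
  (𝕚 ⊗ (fromℕ (suc a) ⊗ (⟦ w ℤ.- + suc a ℤ.≟ b ⟧ ⊗ g (suc a))) ⊕ ι (b ℤ.+ + 1) ⊗ (⟦ w ℤ.- + a ℤ.≟ b ℤ.+ + 1 ⟧ ⊗ g a))
    ⊕ ι κ ⊗ (⟦ w ℤ.- + a ℤ.≟ b ℤ.+ + 1 ⟧ ⊗ g a)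
    ≡⟨ cong₂ (λ d d′ → (𝕚 ⊗ (fromℕ (suc a) ⊗ (d ⊗ g (suc a))) ⊕ ι (b ℤ.+ + 1) ⊗ (d′ ⊗ g a)) ⊕ ι κ ⊗ (d′ ⊗ g a))
             u-shift v-shift ⟩
  (𝕚 ⊗ (fromℕ (suc a) ⊗ (D ⊗ g (suc a))) ⊕ ι (b ℤ.+ + 1) ⊗ (D ⊗ g a)) ⊕ ι κ ⊗ (D ⊗ g a)
    ≡⟨ collect 𝕚 (fromℕ (suc a)) (ι (b ℤ.+ + 1)) (ι κ) D (g (suc a)) (g a) ⟩
  D ⊗ (𝕚 ⊗ (fromℕ (suc a) ⊗ g (suc a)) ⊕ ι (b ℤ.+ + 1 ℤ.+ κ) ⊗ g a)
    ≡⟨ ⟦⟧-⊗-cong (w ℤ.- + 1 ℤ.- + a ℤ.≟ b) (λ eq → cong (λ t → 𝕚 ⊗ (fromℕ (suc a) ⊗ g (suc a)) ⊕ ι t ⊗ g a) (degree eq)) ⟩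
  D ⊗ (𝕚 ⊗ (fromℕ (suc a) ⊗ g (suc a)) ⊕ ι (w ℤ.- + a ℤ.+ κ) ⊗ g a) ∎
  where
  open ≡-Reasoning
  D = ⟦ w ℤ.- + 1 ℤ.- + a ℤ.≟ b ⟧
  u-shift : ⟦ w ℤ.- + suc a ℤ.≟ b ⟧ ≡ D
  u-shift = ⟦≟⟧-cong (shift w (+ a) b)
    where
    shift : ∀ w a b → w ℤ.- (+ 1 ℤ.+ a) ℤ.- b ≡ w ℤ.- + 1 ℤ.- a ℤ.- b
    shift = ℤ-solve-∀
  v-shift : ⟦ w ℤ.- + a ℤ.≟ b ℤ.+ + 1 ⟧ ≡ D
  v-shift = ⟦≟⟧-cong (shift w (+ a) b)
    where
    shift : ∀ w a b → w ℤ.- a ℤ.- (b ℤ.+ + 1) ≡ w ℤ.- + 1 ℤ.- a ℤ.- b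
    shift = ℤ-solve-∀
  collect : ∀ i A B K d g₁ g₀ → (i ⊗ (A ⊗ (d ⊗ g₁)) ⊕ B ⊗ (d ⊗ g₀)) ⊕ K ⊗ (d ⊗ g₀) ≡ d ⊗ (i ⊗ (A ⊗ g₁) ⊕ (B ⊕ K) ⊗ g₀)
  collect = solve-∀ ℤ[i]-ring
  degree : w ℤ.- + 1 ℤ.- + a ≡ b → b ℤ.+ + 1 ℤ.+ κ ≡ w ℤ.- + a ℤ.+ κ
  degree refl = cancel w (+ a) κ
    where
    cancel : ∀ w a κ → w ℤ.- + 1 ℤ.- a ℤ.+ + 1 ℤ.+ κ ≡ w ℤ.- a ℤ.+ κ
    cancel = ℤ-solve-∀

module RaisingClosedForm
  (e : ℤ → ℕ → Fn)
  (R-e : ∀ κ s j → R κ (e s j) ≋ (ι (s ℤ.+ κ) · e (s ℤ.- + 1) j ⊞ e s (suc j)))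
  where

  Riter-closedForm : ∀ m κ s j a b →
    Riter m κ (e s j) a b ≡ ∑[ i < suc m ] (ι (raisingCoeff m (s ℤ.+ κ) i) ⊗ e (s ℤ.- + m ℤ.+ + i) (j + i) a b)
  Riter-closedForm zero κ s j a b =
    sym (trans (⊕-identityʳ (𝟙 ⊗ E)) (trans (⊗-identityˡ E) (cong₂ (λ t u → e t u a b) (s-0+0 s) (+-identityʳ j))))
    where
    E = e (s ℤ.- + 0 ℤ.+ + 0) (j + 0) a b
    s-0+0 : ∀ s → s ℤ.- + 0 ℤ.+ + 0 ≡ s
    s-0+0 = ℤ-solve-∀
  Riter-closedForm (suc m) κ s j a b = begin
    Riter m κ′ (R κ (e s j)) a b
      ≡⟨ Riter-cong m κ′ (R-e κ s j) a b ⟩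
    Riter m κ′ (ι c · e (s ℤ.- + 1) j ⊞ e s (suc j)) a b
      ≡⟨ Riter-⊞ m κ′ (ι c · e (s ℤ.- + 1) j) (e s (suc j)) a b ⟩
    Riter m κ′ (ι c · e (s ℤ.- + 1) j) a b ⊕ Riter m κ′ (e s (suc j)) a b
      ≡⟨ cong (_⊕ Riter m κ′ (e s (suc j)) a b) (Riter-· m κ′ (ι c) (e (s ℤ.- + 1) j) a b) ⟩
    ι c ⊗ Riter m κ′ (e (s ℤ.- + 1) j) a b ⊕ Riter m κ′ (e s (suc j)) a b
      ≡⟨ cong₂ (λ t u → ι c ⊗ t ⊕ u) (Riter-closedForm m κ′ (s ℤ.- + 1) j a b) (Riter-closedForm m κ′ s (suc j) a b) ⟩
    ι c ⊗ ∑[ i < suc m ] (ι (raisingCoeff m (s ℤ.- + 1 ℤ.+ κ′) i) ⊗ e (s ℤ.- + 1 ℤ.- + m ℤ.+ + i) (j + i) a b)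
      ⊕ ∑[ i < suc m ] (ι (raisingCoeff m (s ℤ.+ κ′) i) ⊗ e (s ℤ.- + m ℤ.+ + i) (suc j + i) a b)
      ≡⟨ cong₂ (λ t u → ι c ⊗ t ⊕ u) (∑-cong (suc m) (λ i _ → reindex₁ i)) (∑-cong (suc m) (λ i _ → reindex₂ i)) ⟩
    ι c ⊗ ∑[ i < suc m ] (ι (raisingCoeff m (c ℤ.+ + 1) i) ⊗ E i) ⊕ ∑[ i < suc m ] (ι (raisingCoeff m (c ℤ.+ + 2) i) ⊗ E (suc i))
      ≡⟨ cong (_⊕ ∑[ i < suc m ] (ι (raisingCoeff m (c ℤ.+ + 2) i) ⊗ E (suc i)))
              (⊗-distribˡ-∑ (suc m) (ι c) (λ i → ι (raisingCoeff m (c ℤ.+ + 1) i) ⊗ E i)) ⟩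
    ∑[ i < suc m ] (ι c ⊗ (ι (raisingCoeff m (c ℤ.+ + 1) i) ⊗ E i)) ⊕ ∑[ i < suc m ] (ι (raisingCoeff m (c ℤ.+ + 2) i) ⊗ E (suc i))
      ≡⟨ ∑-pascal m (λ i → ι c ⊗ (ι (raisingCoeff m (c ℤ.+ + 1) i) ⊗ E i)) (λ i → ι (raisingCoeff m (c ℤ.+ + 2) i) ⊗ E (suc i))
                  (λ i → ι (raisingCoeff (suc m) c i) ⊗ E i) first next top ⟩
    ∑[ i < suc (suc m) ] (ι (raisingCoeff (suc m) c i) ⊗ E i) ∎
    where
    open ≡-Reasoning
    κ′ = κ ℤ.+ + 2
    c  = s ℤ.+ κ
    E : ℕ → ℤ[i]
    E i = e (s ℤ.- + suc m ℤ.+ + i) (j + i) a b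
    reindex₁ : ∀ i → ι (raisingCoeff m (s ℤ.- + 1 ℤ.+ κ′) i) ⊗ e (s ℤ.- + 1 ℤ.- + m ℤ.+ + i) (j + i) a b ≡
                     ι (raisingCoeff m (c ℤ.+ + 1) i) ⊗ E i
    reindex₁ i = cong₂ (λ t u → ι (raisingCoeff m t i) ⊗ e u (j + i) a b) (shift s κ) (shift′ s (+ m) (+ i))
      where
      shift : ∀ s κ → s ℤ.- + 1 ℤ.+ (κ ℤ.+ + 2) ≡ s ℤ.+ κ ℤ.+ + 1
      shift = ℤ-solve-∀
      shift′ : ∀ s m i → s ℤ.- + 1 ℤ.- m ℤ.+ i ≡ s ℤ.- (+ 1 ℤ.+ m) ℤ.+ i
      shift′ = ℤ-solve-∀
    reindex₂ : ∀ i → ι (raisingCoeff m (s ℤ.+ κ′) i) ⊗ e (s ℤ.- + m ℤ.+ + i) (suc j + i) a b ≡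
                     ι (raisingCoeff m (c ℤ.+ + 2) i) ⊗ E (suc i)
    reindex₂ i = cong₂ (λ t u → ι (raisingCoeff m t i) ⊗ u) (sym (ℤP.+-assoc s κ (+ 2)))
                       (cong₂ (λ t u → e t u a b) (shift s (+ m) (+ i)) (sym (+-suc j i)))
      where
      shift : ∀ s m i → s ℤ.- m ℤ.+ i ≡ s ℤ.- (+ 1 ℤ.+ m) ℤ.+ (+ 1 ℤ.+ i)
      shift = ℤ-solve-∀
    first : ι (raisingCoeff (suc m) c 0) ⊗ E 0 ≡ ι c ⊗ (ι (raisingCoeff m (c ℤ.+ + 1) 0) ⊗ E 0)
    first = begin
      ι (raisingCoeff (suc m) c 0) ⊗ E 0                     ≡⟨ cong (λ t → ι t ⊗ E 0) (raisingCoeff-zero m c) ⟩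
      ι (c ℤ.* raisingCoeff m (c ℤ.+ + 1) 0) ⊗ E 0           ≡⟨ cong (_⊗ E 0) (ι-* c (raisingCoeff m (c ℤ.+ + 1) 0)) ⟩
      (ι c ⊗ ι (raisingCoeff m (c ℤ.+ + 1) 0)) ⊗ E 0         ≡⟨ ⊗-assoc (ι c) (ι (raisingCoeff m (c ℤ.+ + 1) 0)) (E 0) ⟩
      ι c ⊗ (ι (raisingCoeff m (c ℤ.+ + 1) 0) ⊗ E 0)         ∎
    next : ∀ i → ι (raisingCoeff (suc m) c (suc i)) ⊗ E (suc i) ≡
                 ι c ⊗ (ι (raisingCoeff m (c ℤ.+ + 1) (suc i)) ⊗ E (suc i)) ⊕ ι (raisingCoeff m (c ℤ.+ + 2) i) ⊗ E (suc i)
    next i = begin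
      ι (raisingCoeff (suc m) c (suc i)) ⊗ E (suc i)
        ≡⟨ cong (λ t → ι t ⊗ E (suc i)) (raisingCoeff-pascal m c i) ⟩
      ι (c ℤ.* raisingCoeff m (c ℤ.+ + 1) (suc i) ℤ.+ raisingCoeff m (c ℤ.+ + 2) i) ⊗ E (suc i)
        ≡⟨ cong (λ t → (t ⊕ ι (raisingCoeff m (c ℤ.+ + 2) i)) ⊗ E (suc i)) (ι-* c (raisingCoeff m (c ℤ.+ + 1) (suc i))) ⟩
      (ι c ⊗ ι (raisingCoeff m (c ℤ.+ + 1) (suc i)) ⊕ ι (raisingCoeff m (c ℤ.+ + 2) i)) ⊗ E (suc i)
        ≡⟨ distrib (ι c) (ι (raisingCoeff m (c ℤ.+ + 1) (suc i))) (ι (raisingCoeff m (c ℤ.+ + 2) i)) (E (suc i)) ⟩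
      ι c ⊗ (ι (raisingCoeff m (c ℤ.+ + 1) (suc i)) ⊗ E (suc i)) ⊕ ι (raisingCoeff m (c ℤ.+ + 2) i) ⊗ E (suc i) ∎
      where
      distrib : ∀ x y z w → (x ⊗ y ⊕ z) ⊗ w ≡ x ⊗ (y ⊗ w) ⊕ z ⊗ w
      distrib = solve-∀ ℤ[i]-ring
    top : ι c ⊗ (ι (raisingCoeff m (c ℤ.+ + 1) (suc m)) ⊗ E (suc m)) ≡ 𝟘
    top rewrite raisingCoeff-vanish m (c ℤ.+ + 1) = annihilate (ι c) (E (suc m))
      where
      annihilate : ∀ x y → x ⊗ (𝟘 ⊗ y) ≡ 𝟘
      annihilate = solve-∀ ℤ[i]-ring

-- u-profile of τ^q = Σ_a C(q,a) u^a (iv)^(q-a)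
τᵖ : ℕ → Profile
τᵖ q a = fromℕ (q C a) ⊗ 𝕚 ^ᶜ (q ∸ a)

τᵖ-vanish : ∀ {q a} → q < a → τᵖ q a ≡ 𝟘
τᵖ-vanish {q} {a} q<a rewrite k>n⇒nCk≡0 q<a = 𝟘-⊗ (𝕚 ^ᶜ (q ∸ a))
  where
  𝟘-⊗ : ∀ x → 𝟘 ⊗ x ≡ 𝟘
  𝟘-⊗ = solve-∀ ℤ[i]-ring

τ^-homogeneous : ∀ ℓ → τ^ ℓ ≋ homogeneous (+ ℓ) (τᵖ ℓ)
τ^-homogeneous ℓ a b = begin
  τ^ ℓ a b
    ≡⟨ Σto-homogeneous ℓ (+ ℓ) _ (λ α a → ⟦ α ≟ a ⟧ ⊗ τᵖ ℓ α)
         (λ α α≤ℓ → ·-mono-homogeneous (τᵖ ℓ α) α (+ (ℓ ∸ α)) (+ ℓ) (cong +_ (m+[n∸m]≡n α≤ℓ))) a b ⟩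
  ⟦ + ℓ ℤ.- + a ℤ.≟ b ⟧ ⊗ ∑[ α < suc ℓ ] (⟦ α ≟ a ⟧ ⊗ τᵖ ℓ α)
    ≡⟨ cong (⟦ + ℓ ℤ.- + a ℤ.≟ b ⟧ ⊗_) (∑-⟦≟⟧ (suc ℓ) a (τᵖ ℓ) τᵖ-vanish) ⟩
  ⟦ + ℓ ℤ.- + a ℤ.≟ b ⟧ ⊗ τᵖ ℓ a ∎
  where open ≡-Reasoning

-- The u-profile form of  2i ∂τ τ^q = 2iq τ^(q-1).
τᵖ-step : ∀ q a → 𝕚 ⊗ (fromℕ (suc a) ⊗ τᵖ q (suc a)) ⊕ ι (+ q ℤ.- + a) ⊗ τᵖ q a ≡ (fromℕ 2 ⊗ 𝕚) ⊗ (fromℕ q ⊗ τᵖ (q ∸ 1) a)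
τᵖ-step zero zero    = vanish (fromℕ 1) (fromℕ 2 ⊗ 𝕚) 𝟙
  where
  vanish : ∀ A T y → 𝕚 ⊗ (A ⊗ (𝟘 ⊗ 𝟙)) ⊕ 𝟘 ⊗ (𝟙 ⊗ 𝟙) ≡ T ⊗ (𝟘 ⊗ (𝟙 ⊗ y))
  vanish = solve-∀ ℤ[i]-ring
τᵖ-step zero (suc a) = vanish (fromℕ (suc (suc a))) (ι (+ 0 ℤ.- + suc a)) (fromℕ 2 ⊗ 𝕚)
  where
  vanish : ∀ A K T → 𝕚 ⊗ (A ⊗ (𝟘 ⊗ 𝟙)) ⊕ K ⊗ (𝟘 ⊗ 𝟙) ≡ T ⊗ (𝟘 ⊗ (𝟘 ⊗ 𝟙))
  vanish = solve-∀ ℤ[i]-ring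
τᵖ-step (suc q) a = begin
  𝕚 ⊗ (fromℕ (suc a) ⊗ (fromℕ (suc q C suc a) ⊗ 𝕚 ^ᶜ (q ∸ a))) ⊕ ι (+ suc q ℤ.- + a) ⊗ (fromℕ (suc q C a) ⊗ 𝕚 ^ᶜ (suc q ∸ a))
    ≡⟨ regroup 𝕚 (fromℕ (suc a)) (fromℕ (suc q C suc a)) (𝕚 ^ᶜ (q ∸ a)) (ι (+ suc q ℤ.- + a)) (fromℕ (suc q C a)) (𝕚 ^ᶜ (suc q ∸ a)) ⟩
  𝕚 ⊗ ((fromℕ (suc a) ⊗ fromℕ (suc q C suc a)) ⊗ 𝕚 ^ᶜ (q ∸ a)) ⊕ (ι (+ suc q ℤ.- + a) ⊗ fromℕ (suc q C a)) ⊗ 𝕚 ^ᶜ (suc q ∸ a)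
    ≡⟨ cong₂ (λ t u → 𝕚 ⊗ (t ⊗ 𝕚 ^ᶜ (q ∸ a)) ⊕ u ⊗ 𝕚 ^ᶜ (suc q ∸ a))
             (trans (sym (fromℕ-* (suc a) (suc q C suc a))) (cong fromℕ ([k+1]*[n+1]C[k+1]≡[n+1]*nCk q a)))
             (trans (ι[n-k]⊗nCk≡[n∸k]*nCk (suc q) a) (cong fromℕ ([n+1∸k]*[n+1]Ck≡[n+1]*nCk q a))) ⟩
  𝕚 ⊗ (N ⊗ 𝕚 ^ᶜ (q ∸ a)) ⊕ N ⊗ 𝕚 ^ᶜ (suc q ∸ a)
    ≡⟨ merge ⟩
  (fromℕ 2 ⊗ 𝕚) ⊗ N ⊗ 𝕚 ^ᶜ (q ∸ a)
    ≡⟨ regroup′ (fromℕ (suc q)) (fromℕ (q C a)) (𝕚 ^ᶜ (q ∸ a)) (fromℕ-* (suc q) (q C a)) ⟩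
  (fromℕ 2 ⊗ 𝕚) ⊗ (fromℕ (suc q) ⊗ τᵖ q a) ∎
  where
  open ≡-Reasoning
  N = fromℕ (suc q * (q C a))
  regroup : ∀ i A B Z K C Z′ → i ⊗ (A ⊗ (B ⊗ Z)) ⊕ K ⊗ (C ⊗ Z′) ≡ i ⊗ ((A ⊗ B) ⊗ Z) ⊕ (K ⊗ C) ⊗ Z′
  regroup = solve-∀ ℤ[i]-ring
  regroup′ : ∀ Q B Z → N ≡ Q ⊗ B → (fromℕ 2 ⊗ 𝕚) ⊗ N ⊗ Z ≡ (fromℕ 2 ⊗ 𝕚) ⊗ (Q ⊗ (B ⊗ Z))
  regroup′ Q B Z N≡QB = trans (cong (λ t → (fromℕ 2 ⊗ 𝕚) ⊗ t ⊗ Z) N≡QB) (assoc Q B Z)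
    where
    assoc : ∀ Q B Z → (fromℕ 2 ⊗ 𝕚) ⊗ (Q ⊗ B) ⊗ Z ≡ (fromℕ 2 ⊗ 𝕚) ⊗ (Q ⊗ (B ⊗ Z))
    assoc = solve-∀ ℤ[i]-ring
  merge : 𝕚 ⊗ (N ⊗ 𝕚 ^ᶜ (q ∸ a)) ⊕ N ⊗ 𝕚 ^ᶜ (suc q ∸ a) ≡ (fromℕ 2 ⊗ 𝕚) ⊗ N ⊗ 𝕚 ^ᶜ (q ∸ a)
  merge with a ≤? q
  ... | yes a≤q rewrite +-∸-assoc 1 a≤q = double N (𝕚 ^ᶜ (q ∸ a))
    where
    double : ∀ N Z → 𝕚 ⊗ (N ⊗ Z) ⊕ N ⊗ (𝕚 ⊗ Z) ≡ (fromℕ 2 ⊗ 𝕚) ⊗ N ⊗ Z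
    double = solve-∀ ℤ[i]-ring
  ... | no a≰q rewrite k>n⇒nCk≡0 (≰⇒> a≰q) | *-zeroʳ q = vanish (𝕚 ^ᶜ (q ∸ a)) (𝕚 ^ᶜ (suc q ∸ a))
    where
    vanish : ∀ Z Z′ → 𝕚 ⊗ (𝟘 ⊗ Z) ⊕ 𝟘 ⊗ Z′ ≡ (fromℕ 2 ⊗ 𝕚) ⊗ 𝟘 ⊗ Z
    vanish = solve-∀ ℤ[i]-ring

-- u-profile of (2i ∂/∂τ)^j τ^q = (2i)^j q(q-1)⋯(q-j+1) τ^(q-j)
Dτᵖ : ℕ → ℕ → Profile
Dτᵖ q j a = ((fromℕ 2 ⊗ 𝕚) ^ᶜ j ⊗ fromℕ (q P′ j)) ⊗ τᵖ (q ∸ j) a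

Dτᵖ-step : ∀ q j a → 𝕚 ⊗ (fromℕ (suc a) ⊗ Dτᵖ q j (suc a)) ⊕ ι (+ q ℤ.- + j ℤ.- + a) ⊗ Dτᵖ q j a ≡ Dτᵖ q (suc j) a
Dτᵖ-step q j a with j ≤? q
... | yes j≤q = begin
  𝕚 ⊗ (fromℕ (suc a) ⊗ (K ⊗ τᵖ Q (suc a))) ⊕ ι (+ q ℤ.- + j ℤ.- + a) ⊗ (K ⊗ τᵖ Q a)
    ≡⟨ cong (λ t → 𝕚 ⊗ (fromℕ (suc a) ⊗ (K ⊗ τᵖ Q (suc a))) ⊕ ι (t ℤ.- + a) ⊗ (K ⊗ τᵖ Q a)) (pos-∸ j≤q) ⟩
  𝕚 ⊗ (fromℕ (suc a) ⊗ (K ⊗ τᵖ Q (suc a))) ⊕ ι (+ Q ℤ.- + a) ⊗ (K ⊗ τᵖ Q a)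
    ≡⟨ factor K 𝕚 (fromℕ (suc a)) (τᵖ Q (suc a)) (ι (+ Q ℤ.- + a)) (τᵖ Q a) ⟩
  K ⊗ (𝕚 ⊗ (fromℕ (suc a) ⊗ τᵖ Q (suc a)) ⊕ ι (+ Q ℤ.- + a) ⊗ τᵖ Q a)
    ≡⟨ cong (K ⊗_) (τᵖ-step Q a) ⟩
  K ⊗ ((fromℕ 2 ⊗ 𝕚) ⊗ (fromℕ Q ⊗ τᵖ (Q ∸ 1) a))
    ≡⟨ regroup ((fromℕ 2 ⊗ 𝕚) ^ᶜ j) (fromℕ (q P′ j)) (fromℕ Q) (τᵖ (Q ∸ 1) a) ⟩
  ((fromℕ 2 ⊗ 𝕚) ^ᶜ suc j ⊗ (fromℕ (q P′ j) ⊗ fromℕ Q)) ⊗ τᵖ (Q ∸ 1) a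
    ≡⟨ cong₂ (λ t u → ((fromℕ 2 ⊗ 𝕚) ^ᶜ suc j ⊗ t) ⊗ τᵖ u a)
             (trans (sym (fromℕ-* (q P′ j) Q)) (cong fromℕ (*-comm (q P′ j) Q)))
             (trans (∸-+-assoc q j 1) (cong (q ∸_) (+-comm j 1))) ⟩
  ((fromℕ 2 ⊗ 𝕚) ^ᶜ suc j ⊗ fromℕ (q P′ suc j)) ⊗ τᵖ (q ∸ suc j) a ∎
  where
  open ≡-Reasoning
  K = (fromℕ 2 ⊗ 𝕚) ^ᶜ j ⊗ fromℕ (q P′ j)
  Q = q ∸ j
  factor : ∀ K i A x B y → i ⊗ (A ⊗ (K ⊗ x)) ⊕ B ⊗ (K ⊗ y) ≡ K ⊗ (i ⊗ (A ⊗ x) ⊕ B ⊗ y)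
  factor = solve-∀ ℤ[i]-ring
  regroup : ∀ T F Q x → (T ⊗ F) ⊗ ((fromℕ 2 ⊗ 𝕚) ⊗ (Q ⊗ x)) ≡ ((fromℕ 2 ⊗ 𝕚) ⊗ T ⊗ (F ⊗ Q)) ⊗ x
  regroup = solve-∀ ℤ[i]-ring
... | no j≰q rewrite k>n⇒nP′k≡0 (≰⇒> j≰q) | *-zeroʳ (q ∸ j) =
  vanish 𝕚 (fromℕ (suc a)) ((fromℕ 2 ⊗ 𝕚) ^ᶜ j) (τᵖ (q ∸ j) (suc a)) (ι (+ q ℤ.- + j ℤ.- + a)) (τᵖ (q ∸ j) a)
         ((fromℕ 2 ⊗ 𝕚) ^ᶜ suc j) (τᵖ (q ∸ suc j) a)
  where
  vanish : ∀ i A T x B y T′ z → i ⊗ (A ⊗ ((T ⊗ 𝟘) ⊗ x)) ⊕ B ⊗ ((T ⊗ 𝟘) ⊗ y) ≡ (T′ ⊗ 𝟘) ⊗ z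
  vanish = solve-∀ ℤ[i]-ring

-- v^s (2i ∂/∂τ)^j τ^q
vτ : ℕ → ℤ → ℕ → Fn
vτ q s j = homogeneous (s ℤ.+ + q ℤ.- + j) (Dτᵖ q j)

R-vτ : ∀ q κ s j → R κ (vτ q s j) ≋ (ι (s ℤ.+ κ) · vτ q (s ℤ.- + 1) j ⊞ vτ q s (suc j))
R-vτ q κ s j a b = begin
  R κ (vτ q s j) a b
    ≡⟨ R-homogeneous κ w (Dτᵖ q j) a b ⟩
  D ⊗ (𝕚 ⊗ (fromℕ (suc a) ⊗ Dτᵖ q j (suc a)) ⊕ ι (w ℤ.- + a ℤ.+ κ) ⊗ Dτᵖ q j a)
    ≡⟨ cong (λ t → D ⊗ (𝕚 ⊗ (fromℕ (suc a) ⊗ Dτᵖ q j (suc a)) ⊕ ι t ⊗ Dτᵖ q j a)) (split s (+ q) (+ j) (+ a) κ) ⟩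
  D ⊗ (𝕚 ⊗ (fromℕ (suc a) ⊗ Dτᵖ q j (suc a)) ⊕ (ι (s ℤ.+ κ) ⊕ ι (+ q ℤ.- + j ℤ.- + a)) ⊗ Dτᵖ q j a)
    ≡⟨ regroup D (ι (s ℤ.+ κ)) 𝕚 (fromℕ (suc a)) (Dτᵖ q j (suc a)) (ι (+ q ℤ.- + j ℤ.- + a)) (Dτᵖ q j a) ⟩
  ι (s ℤ.+ κ) ⊗ (D ⊗ Dτᵖ q j a) ⊕ D ⊗ (𝕚 ⊗ (fromℕ (suc a) ⊗ Dτᵖ q j (suc a)) ⊕ ι (+ q ℤ.- + j ℤ.- + a) ⊗ Dτᵖ q j a)
    ≡⟨ cong (λ t → ι (s ℤ.+ κ) ⊗ (D ⊗ Dτᵖ q j a) ⊕ D ⊗ t) (Dτᵖ-step q j a) ⟩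
  ι (s ℤ.+ κ) ⊗ (D ⊗ Dτᵖ q j a) ⊕ D ⊗ Dτᵖ q (suc j) a
    ≡⟨ cong₂ (λ t u → ι (s ℤ.+ κ) ⊗ (⟦ t ℤ.- + a ℤ.≟ b ⟧ ⊗ Dτᵖ q j a) ⊕ ⟦ u ℤ.- + a ℤ.≟ b ⟧ ⊗ Dτᵖ q (suc j) a)
             (lower s (+ q) (+ j)) (lower′ s (+ q) (+ j)) ⟩
  ι (s ℤ.+ κ) ⊗ vτ q (s ℤ.- + 1) j a b ⊕ vτ q s (suc j) a b ∎
  where
  open ≡-Reasoning
  w = s ℤ.+ + q ℤ.- + j
  D = ⟦ w ℤ.- + 1 ℤ.- + a ℤ.≟ b ⟧
  split : ∀ s q j a κ → s ℤ.+ q ℤ.- j ℤ.- a ℤ.+ κ ≡ s ℤ.+ κ ℤ.+ (q ℤ.- j ℤ.- a)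
  split = ℤ-solve-∀
  lower : ∀ s q j → s ℤ.+ q ℤ.- j ℤ.- + 1 ≡ s ℤ.- + 1 ℤ.+ q ℤ.- j
  lower = ℤ-solve-∀
  lower′ : ∀ s q j → s ℤ.+ q ℤ.- j ℤ.- + 1 ≡ s ℤ.+ q ℤ.- (+ 1 ℤ.+ j)
  lower′ = ℤ-solve-∀
  regroup : ∀ D C i A x B y → D ⊗ (i ⊗ (A ⊗ x) ⊕ (C ⊕ B) ⊗ y) ≡ C ⊗ (D ⊗ y) ⊕ D ⊗ (i ⊗ (A ⊗ x) ⊕ B ⊗ y)
  regroup = solve-∀ ℤ[i]-ring

τ^-vτ : ∀ ℓ → τ^ ℓ ≋ vτ ℓ (+ 0) 0
τ^-vτ ℓ a b = trans (τ^-homogeneous ℓ a b) (homogeneous-cong (sym (cong +_ (+-identityʳ ℓ))) (λ a → sym (unit (τᵖ ℓ a))) a b)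
  where
  unit : ∀ x → (𝟙 ⊗ 𝟙) ⊗ x ≡ x
  unit = solve-∀ ℤ[i]-ring

κ₀ : ℕ → ℤ
κ₀ n = + 2 ℤ.- + (2 * suc n)

R^[k-1]τ^-homogeneous : ∀ n ℓ → R^[k-1] (suc n) (τ^ ℓ) ≋
  homogeneous (+ ℓ ℤ.- + n) (λ a → ∑[ i < suc n ] (ι (raisingCoeff n (+ 0 ℤ.+ κ₀ n) i) ⊗ Dτᵖ ℓ i a))
R^[k-1]τ^-homogeneous n ℓ a b = begin
  Riter n (κ₀ n) (τ^ ℓ) a b
    ≡⟨ Riter-cong n (κ₀ n) (τ^-vτ ℓ) a b ⟩
  Riter n (κ₀ n) (vτ ℓ (+ 0) 0) a b
    ≡⟨ RaisingClosedForm.Riter-closedForm (vτ ℓ) (R-vτ ℓ) n (κ₀ n) (+ 0) 0 a b ⟩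
  ∑[ i < suc n ] (ι (c i) ⊗ vτ ℓ (+ 0 ℤ.- + n ℤ.+ + i) i a b)
    ≡⟨ ∑-cong (suc n) (λ i _ → trans (cong (λ t → ι (c i) ⊗ (⟦ t ℤ.- + a ℤ.≟ b ⟧ ⊗ Dτᵖ ℓ i a)) (degree (+ n) (+ i) (+ ℓ)))
                                     (swap (ι (c i)) D (Dτᵖ ℓ i a))) ⟩
  ∑[ i < suc n ] (D ⊗ (ι (c i) ⊗ Dτᵖ ℓ i a))
    ≡⟨ sym (⊗-distribˡ-∑ (suc n) D (λ i → ι (c i) ⊗ Dτᵖ ℓ i a)) ⟩
  D ⊗ ∑[ i < suc n ] (ι (c i) ⊗ Dτᵖ ℓ i a) ∎
  where
  open ≡-Reasoning
  c = raisingCoeff n (+ 0 ℤ.+ κ₀ n)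
  D = ⟦ + ℓ ℤ.- + n ℤ.- + a ℤ.≟ b ⟧
  degree : ∀ n i ℓ → + 0 ℤ.- n ℤ.+ i ℤ.+ ℓ ℤ.- i ≡ ℓ ℤ.- n
  degree = ℤ-solve-∀
  swap : ∀ c d x → c ⊗ (d ⊗ x) ≡ d ⊗ (c ⊗ x)
  swap = solve-∀ ℤ[i]-ring

2*[1+n]≡2+2n : ∀ n → 2 * suc n ≡ 2 + (n + n)
2*[1+n]≡2+2n = ℕ-solve-∀

κ₀+i≡-[n∸i+n] : ∀ n i → i ≤ n → + 0 ℤ.+ κ₀ n ℤ.+ + i ≡ - + (n ∸ i + n)
κ₀+i≡-[n∸i+n] n i i≤n = begin
  + 0 ℤ.+ (+ 2 ℤ.- + (2 * suc n)) ℤ.+ + i          ≡⟨ cong (λ t → + 0 ℤ.+ (+ 2 ℤ.- + t) ℤ.+ + i) (2*[1+n]≡2+2n n) ⟩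
  + 0 ℤ.+ (+ 2 ℤ.- + (2 + (n + n))) ℤ.+ + i        ≡⟨ cong (λ t → + 0 ℤ.+ (+ 2 ℤ.- + (2 + (t + t))) ℤ.+ + i) (sym (m∸n+n≡m i≤n)) ⟩
  + 0 ℤ.+ (+ 2 ℤ.- + (2 + ((n ∸ i + i) + (n ∸ i + i)))) ℤ.+ + i
    ≡⟨ cancel (+ (n ∸ i)) (+ i) ⟩
  - (+ (n ∸ i) ℤ.+ (+ (n ∸ i) ℤ.+ + i))            ≡⟨ cong (λ t → - (+ (n ∸ i) ℤ.+ + t)) (m∸n+n≡m i≤n) ⟩
  - + (n ∸ i + n)                                  ∎
  where
  open ≡-Reasoning
  cancel : ∀ x y → + 0 ℤ.+ (+ 2 ℤ.- (+ 2 ℤ.+ ((x ℤ.+ y) ℤ.+ (x ℤ.+ y)))) ℤ.+ y ≡ - (x ℤ.+ (x ℤ.+ y))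
  cancel = ℤ-solve-∀

ratio≡[n∸j+n]P′n : ∀ n j → j ≤ n → ratio (suc n) j ≡ (n ∸ j + n) P′ n
ratio≡[n∸j+n]P′n n j j≤n = begin
  ((2 * suc n ∸ 2 ∸ j) !) / ((n ∸ j) !)      ≡⟨ /-congˡ (cong _! numerator) ⟩
  ((n ∸ j + n) !) / ((n ∸ j) !)              ≡⟨ /-congʳ (cong _! (sym (m+n∸n≡m (n ∸ j) n))) ⟩
  ((n ∸ j + n) !) / ((n ∸ j + n ∸ n) !)      ≡⟨ sym (nP′k≡n!/[n∸k]! (m≤n+m n (n ∸ j))) ⟩
  (n ∸ j + n) P′ n                           ∎
  where
  open ≡-Reasoning
  instance
    _ = (n ∸ j) !≢0
    _ = (n ∸ j + n ∸ n) !≢0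
  numerator : 2 * suc n ∸ 2 ∸ j ≡ n ∸ j + n
  numerator = trans (cong (λ t → t ∸ 2 ∸ j) (2*[1+n]≡2+2n n)) (+-∸-comm n j≤n)

nCi*ℓP′i*[n∸i+n]P′[n∸i]≡ℓCi*ratio : ∀ n ℓ i → i ≤ n →
  (n C i) * (ℓ P′ i) * ((n ∸ i + n) P′ (n ∸ i)) ≡ (ℓ C i) * ratio (suc n) i
nCi*ℓP′i*[n∸i+n]P′[n∸i]≡ℓCi*ratio n ℓ i i≤n = begin
  (n C i) * (ℓ P′ i) * (M P′ (n ∸ i))                ≡⟨ cong (λ t → (n C i) * t * (M P′ (n ∸ i))) (sym (nCk*k!≡nP′k ℓ i)) ⟩
  (n C i) * ((ℓ C i) * i !) * (M P′ (n ∸ i))         ≡⟨ regroup (n C i) (ℓ C i) (i !) (M P′ (n ∸ i)) ⟩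
  (ℓ C i) * ((M P′ (n ∸ i)) * ((n C i) * i !))       ≡⟨ cong (λ t → (ℓ C i) * ((M P′ (n ∸ i)) * t)) (nCk*k!≡nP′k n i) ⟩
  (ℓ C i) * ((M P′ (n ∸ i)) * (n P′ i))              ≡⟨ cong (λ t → (ℓ C i) * ((M P′ (n ∸ i)) * (t P′ i))) (sym (m+n∸m≡n (n ∸ i) n)) ⟩
  (ℓ C i) * ((M P′ (n ∸ i)) * ((M ∸ (n ∸ i)) P′ i))  ≡⟨ cong ((ℓ C i) *_) (sym (nP′[j+k]≡nP′j*[n∸j]P′k M (n ∸ i) i)) ⟩
  (ℓ C i) * (M P′ (n ∸ i + i))                       ≡⟨ cong (λ t → (ℓ C i) * (M P′ t)) (m∸n+n≡m i≤n) ⟩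
  (ℓ C i) * (M P′ n)                                 ≡⟨ cong ((ℓ C i) *_) (sym (ratio≡[n∸j+n]P′n n i i≤n)) ⟩
  (ℓ C i) * ratio (suc n) i                          ∎
  where
  open ≡-Reasoning
  M = n ∸ i + n
  regroup : ∀ a b c d → a * (b * c) * d ≡ b * (d * (a * c))
  regroup = ℕ-solve-∀

-- Writing 2i = (-1)(-2) i turns the (-1)^(n-i) of the rising factorial into (-1)^n (-2)^i.
sign-powers : ∀ n i m → i ≤ n →
  ι (- + 1) ^ᶜ (n ∸ i) ⊗ (fromℕ 2 ⊗ 𝕚) ^ᶜ i ⊗ 𝕚 ^ᶜ m ≡ ι (- + 1) ^ᶜ n ⊗ 𝕚 ^ᶜ (i + m) ⊗ ι (- + 2) ^ᶜ i
sign-powers n i m i≤n = begin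
  σ ^ᶜ (n ∸ i) ⊗ ((σ ⊗ ι (- + 2)) ⊗ 𝕚) ^ᶜ i ⊗ 𝕚 ^ᶜ m
    ≡⟨ cong (λ t → σ ^ᶜ (n ∸ i) ⊗ t ⊗ 𝕚 ^ᶜ m)
            (trans (^ᶜ-distribʳ-⊗ (σ ⊗ ι (- + 2)) 𝕚 i) (cong (_⊗ 𝕚 ^ᶜ i) (^ᶜ-distribʳ-⊗ σ (ι (- + 2)) i))) ⟩
  σ ^ᶜ (n ∸ i) ⊗ (σ ^ᶜ i ⊗ ι (- + 2) ^ᶜ i ⊗ 𝕚 ^ᶜ i) ⊗ 𝕚 ^ᶜ m
    ≡⟨ regroup (σ ^ᶜ (n ∸ i)) (σ ^ᶜ i) (ι (- + 2) ^ᶜ i) (𝕚 ^ᶜ i) (𝕚 ^ᶜ m) ⟩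
  (σ ^ᶜ (n ∸ i) ⊗ σ ^ᶜ i) ⊗ (𝕚 ^ᶜ i ⊗ 𝕚 ^ᶜ m) ⊗ ι (- + 2) ^ᶜ i
    ≡⟨ cong₂ (λ t u → t ⊗ u ⊗ ι (- + 2) ^ᶜ i)
             (trans (sym (^ᶜ-+ σ (n ∸ i) i)) (cong (σ ^ᶜ_) (m∸n+n≡m i≤n))) (sym (^ᶜ-+ 𝕚 i m)) ⟩
  σ ^ᶜ n ⊗ 𝕚 ^ᶜ (i + m) ⊗ ι (- + 2) ^ᶜ i ∎
  where
  open ≡-Reasoning
  σ = ι (- + 1)
  regroup : ∀ s s′ t i j → s ⊗ (s′ ⊗ t ⊗ i) ⊗ j ≡ (s ⊗ s′) ⊗ (i ⊗ j) ⊗ t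
  regroup = solve-∀ ℤ[i]-ring

rhsCoeff : ℕ → ℕ → ℕ → ℤ[i]
rhsCoeff k ℓ j = ι (+ (ℓ C j)) ⊗ ι (+ ratio k j) ⊗ (ι (- + 2) ^ᶜ j)

raisingTerm-factored : ∀ n ℓ a i → i ≤ n →
  ι (raisingCoeff n (+ 0 ℤ.+ κ₀ n) i) ⊗ Dτᵖ ℓ i a ≡
  (ι (- + 1) ^ᶜ (n ∸ i) ⊗ (fromℕ 2 ⊗ 𝕚) ^ᶜ i ⊗ 𝕚 ^ᶜ (ℓ ∸ i ∸ a)) ⊗
    ((fromℕ (ℓ C i) ⊗ fromℕ (ratio (suc n) i)) ⊗ fromℕ ((ℓ ∸ i) C a))
raisingTerm-factored n ℓ a i i≤n = begin
  ι (+ (n C i) ℤ.* (c ↑ (n ∸ i))) ⊗ ((T ⊗ L) ⊗ (B ⊗ Z))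
    ≡⟨ cong (_⊗ ((T ⊗ L) ⊗ (B ⊗ Z))) (trans (ι-* (+ (n C i)) (c ↑ (n ∸ i)))
                                            (cong (λ t → fromℕ (n C i) ⊗ ι (t ↑ (n ∸ i))) (κ₀+i≡-[n∸i+n] n i i≤n))) ⟩
  fromℕ (n C i) ⊗ ι ((- + M) ↑ (n ∸ i)) ⊗ ((T ⊗ L) ⊗ (B ⊗ Z))
    ≡⟨ cong (λ t → fromℕ (n C i) ⊗ t ⊗ ((T ⊗ L) ⊗ (B ⊗ Z))) (ι-↑-neg M (n ∸ i)) ⟩
  fromℕ (n C i) ⊗ (σ ⊗ fromℕ (M P′ (n ∸ i))) ⊗ ((T ⊗ L) ⊗ (B ⊗ Z))
    ≡⟨ separate (fromℕ (n C i)) σ (fromℕ (M P′ (n ∸ i))) T L B Z ⟩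
  (σ ⊗ T ⊗ Z) ⊗ ((fromℕ (n C i) ⊗ L ⊗ fromℕ (M P′ (n ∸ i))) ⊗ B)
    ≡⟨ cong (λ t → (σ ⊗ T ⊗ Z) ⊗ (t ⊗ B)) coefficient ⟩
  (σ ⊗ T ⊗ Z) ⊗ ((fromℕ (ℓ C i) ⊗ fromℕ (ratio (suc n) i)) ⊗ B) ∎
  where
  open ≡-Reasoning
  M = n ∸ i + n
  c = + 0 ℤ.+ κ₀ n ℤ.+ + i
  σ = ι (- + 1) ^ᶜ (n ∸ i)
  T = (fromℕ 2 ⊗ 𝕚) ^ᶜ i
  L = fromℕ (ℓ P′ i)
  B = fromℕ ((ℓ ∸ i) C a)
  Z = 𝕚 ^ᶜ (ℓ ∸ i ∸ a)
  separate : ∀ c s m t p b z → c ⊗ (s ⊗ m) ⊗ ((t ⊗ p) ⊗ (b ⊗ z)) ≡ (s ⊗ t ⊗ z) ⊗ ((c ⊗ p ⊗ m) ⊗ b)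
  separate = solve-∀ ℤ[i]-ring
  coefficient : fromℕ (n C i) ⊗ L ⊗ fromℕ (M P′ (n ∸ i)) ≡ fromℕ (ℓ C i) ⊗ fromℕ (ratio (suc n) i)
  coefficient = begin
    fromℕ (n C i) ⊗ fromℕ (ℓ P′ i) ⊗ fromℕ (M P′ (n ∸ i))  ≡⟨ cong (_⊗ fromℕ (M P′ (n ∸ i))) (sym (fromℕ-* (n C i) (ℓ P′ i))) ⟩
    fromℕ ((n C i) * (ℓ P′ i)) ⊗ fromℕ (M P′ (n ∸ i))      ≡⟨ sym (fromℕ-* ((n C i) * (ℓ P′ i)) (M P′ (n ∸ i))) ⟩
    fromℕ ((n C i) * (ℓ P′ i) * (M P′ (n ∸ i)))            ≡⟨ cong fromℕ (nCi*ℓP′i*[n∸i+n]P′[n∸i]≡ℓCi*ratio n ℓ i i≤n) ⟩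
    fromℕ ((ℓ C i) * ratio (suc n) i)                       ≡⟨ fromℕ-* (ℓ C i) (ratio (suc n) i) ⟩
    fromℕ (ℓ C i) ⊗ fromℕ (ratio (suc n) i)                 ∎

prefactor-rearrange : ∀ n ℓ a i → i ≤ n →
  (ι (- + 1) ^ᶜ (n ∸ i) ⊗ (fromℕ 2 ⊗ 𝕚) ^ᶜ i ⊗ 𝕚 ^ᶜ (ℓ ∸ i ∸ a)) ⊗
    ((fromℕ (ℓ C i) ⊗ fromℕ (ratio (suc n) i)) ⊗ fromℕ ((ℓ ∸ i) C a))
  ≡ (ι (- + 1) ^ᶜ n ⊗ 𝕚 ^ᶜ (ℓ ∸ a)) ⊗ (rhsCoeff (suc n) ℓ i ⊗ fromℕ ((ℓ ∸ i) C a))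
prefactor-rearrange n ℓ a i i≤n with i ≤? ℓ ∸ a
... | yes i≤ℓ∸a = begin
  (ι (- + 1) ^ᶜ (n ∸ i) ⊗ (fromℕ 2 ⊗ 𝕚) ^ᶜ i ⊗ 𝕚 ^ᶜ (ℓ ∸ i ∸ a)) ⊗ (K ⊗ B)
    ≡⟨ cong (_⊗ (K ⊗ B)) (sign-powers n i (ℓ ∸ i ∸ a) i≤n) ⟩
  (ι (- + 1) ^ᶜ n ⊗ 𝕚 ^ᶜ (i + (ℓ ∸ i ∸ a)) ⊗ ι (- + 2) ^ᶜ i) ⊗ (K ⊗ B)
    ≡⟨ cong (λ t → (ι (- + 1) ^ᶜ n ⊗ 𝕚 ^ᶜ t ⊗ ι (- + 2) ^ᶜ i) ⊗ (K ⊗ B))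
            (trans (cong (_+_ i) (∸-exchange ℓ i a)) (m+[n∸m]≡n i≤ℓ∸a)) ⟩
  (ι (- + 1) ^ᶜ n ⊗ 𝕚 ^ᶜ (ℓ ∸ a) ⊗ ι (- + 2) ^ᶜ i) ⊗ (K ⊗ B)
    ≡⟨ regroup (ι (- + 1) ^ᶜ n ⊗ 𝕚 ^ᶜ (ℓ ∸ a)) (ι (- + 2) ^ᶜ i) K B ⟩
  (ι (- + 1) ^ᶜ n ⊗ 𝕚 ^ᶜ (ℓ ∸ a)) ⊗ (rhsCoeff (suc n) ℓ i ⊗ B) ∎
  where
  open ≡-Reasoning
  K = fromℕ (ℓ C i) ⊗ fromℕ (ratio (suc n) i)
  B = fromℕ ((ℓ ∸ i) C a)
  regroup : ∀ s t c b → (s ⊗ t) ⊗ (c ⊗ b) ≡ s ⊗ ((c ⊗ t) ⊗ b)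
  regroup = solve-∀ ℤ[i]-ring
  ∸-exchange : ∀ ℓ i a → ℓ ∸ i ∸ a ≡ ℓ ∸ a ∸ i
  ∸-exchange ℓ i a = trans (∸-+-assoc ℓ i a) (trans (cong (ℓ ∸_) (+-comm i a)) (sym (∸-+-assoc ℓ a i)))
... | no i≰ℓ∸a = both-vanish (ι (- + 1) ^ᶜ (n ∸ i) ⊗ (fromℕ 2 ⊗ 𝕚) ^ᶜ i ⊗ 𝕚 ^ᶜ (ℓ ∸ i ∸ a)) (ι (- + 1) ^ᶜ n ⊗ 𝕚 ^ᶜ (ℓ ∸ a))
                              (fromℕ (ℓ C i)) (fromℕ (ratio (suc n) i)) (ι (- + 2) ^ᶜ i) (fromℕ ((ℓ ∸ i) C a)) outside
  where
  open ≡-Reasoning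
  outside : fromℕ (ℓ C i) ⊗ fromℕ ((ℓ ∸ i) C a) ≡ 𝟘
  outside = begin
    fromℕ (ℓ C i) ⊗ fromℕ ((ℓ ∸ i) C a)  ≡⟨ sym (fromℕ-* (ℓ C i) ((ℓ ∸ i) C a)) ⟩
    fromℕ ((ℓ C i) * ((ℓ ∸ i) C a))      ≡⟨ cong fromℕ (nCj*[n∸j]Ck≡nCk*[n∸k]Cj ℓ i a) ⟩
    fromℕ ((ℓ C a) * ((ℓ ∸ a) C i))      ≡⟨ cong (λ t → fromℕ ((ℓ C a) * t)) (k>n⇒nCk≡0 (≰⇒> i≰ℓ∸a)) ⟩
    fromℕ ((ℓ C a) * 0)                  ≡⟨ cong fromℕ (*-zeroʳ (ℓ C a)) ⟩
    𝟘                                    ∎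
  both-vanish : ∀ p q c r t b → c ⊗ b ≡ 𝟘 → p ⊗ ((c ⊗ r) ⊗ b) ≡ q ⊗ ((c ⊗ r ⊗ t) ⊗ b)
  both-vanish p q c r t b cb≡0 = begin
    p ⊗ ((c ⊗ r) ⊗ b)         ≡⟨ isolate p c r b ⟩
    (p ⊗ r) ⊗ (c ⊗ b)         ≡⟨ cong ((p ⊗ r) ⊗_) cb≡0 ⟩
    (p ⊗ r) ⊗ 𝟘               ≡⟨ annihilate (p ⊗ r) (q ⊗ (r ⊗ t)) ⟩
    (q ⊗ (r ⊗ t)) ⊗ 𝟘         ≡⟨ cong ((q ⊗ (r ⊗ t)) ⊗_) (sym cb≡0) ⟩
    (q ⊗ (r ⊗ t)) ⊗ (c ⊗ b)   ≡⟨ isolate′ q c r t b ⟩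
    q ⊗ ((c ⊗ r ⊗ t) ⊗ b)     ∎
    where
    isolate : ∀ p c r b → p ⊗ ((c ⊗ r) ⊗ b) ≡ (p ⊗ r) ⊗ (c ⊗ b)
    isolate = solve-∀ ℤ[i]-ring
    annihilate : ∀ x y → x ⊗ 𝟘 ≡ y ⊗ 𝟘
    annihilate = solve-∀ ℤ[i]-ring
    isolate′ : ∀ q c r t b → (q ⊗ (r ⊗ t)) ⊗ (c ⊗ b) ≡ q ⊗ ((c ⊗ r ⊗ t) ⊗ b)
    isolate′ = solve-∀ ℤ[i]-ring

raisingTerm : ∀ n ℓ a i → i ≤ n →
  ι (raisingCoeff n (+ 0 ℤ.+ κ₀ n) i) ⊗ Dτᵖ ℓ i a ≡ (ι (- + 1) ^ᶜ n ⊗ 𝕚 ^ᶜ (ℓ ∸ a)) ⊗ (rhsCoeff (suc n) ℓ i ⊗ fromℕ ((ℓ ∸ i) C a))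
raisingTerm n ℓ a i i≤n = trans (raisingTerm-factored n ℓ a i i≤n) (prefactor-rearrange n ℓ a i i≤n)

R^[k-1]τ^ᵖ : ∀ n ℓ a →
  ∑[ i < suc n ] (ι (raisingCoeff n (+ 0 ℤ.+ κ₀ n) i) ⊗ Dτᵖ ℓ i a) ≡
  (ι (- + 1) ^ᶜ n ⊗ 𝕚 ^ᶜ (ℓ ∸ a)) ⊗ ∑[ j < suc n ] (rhsCoeff (suc n) ℓ j ⊗ fromℕ ((ℓ ∸ j) C a))
R^[k-1]τ^ᵖ n ℓ a =
  trans (∑-cong (suc n) (λ i i<1+n → raisingTerm n ℓ a i (≤-pred i<1+n)))
        (sym (⊗-distribˡ-∑ (suc n) (ι (- + 1) ^ᶜ n ⊗ 𝕚 ^ᶜ (ℓ ∸ a)) (λ j → rhsCoeff (suc n) ℓ j ⊗ fromℕ ((ℓ ∸ j) C a))))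

-- G N r m is the coefficient of x^N in (1 - 2x)^m / (1 - x)^(r+1).
G : ℕ → ℕ → ℕ → ℤ[i]
G N r m = ∑[ j < suc N ] (fromℕ (m C j) ⊗ (ι (- + 2) ^ᶜ j ⊗ fromℕ ((N ∸ j + r) C r)))

∑rhsCoeff≡G : ∀ n ℓ a → ∑[ j < suc n ] (rhsCoeff (suc n) ℓ j ⊗ fromℕ ((ℓ ∸ j) C a)) ≡ (fromℕ (ℓ C a) ⊗ fromℕ (n !)) ⊗ G n n (ℓ ∸ a)
∑rhsCoeff≡G n ℓ a =
  trans (∑-cong (suc n) (λ j j<1+n → summand j (≤-pred j<1+n)))
        (sym (⊗-distribˡ-∑ (suc n) (fromℕ (ℓ C a) ⊗ fromℕ (n !)) (λ j → fromℕ ((ℓ ∸ a) C j) ⊗ (ι (- + 2) ^ᶜ j ⊗ fromℕ ((n ∸ j + n) C n)))))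
  where
  summand : ∀ j → j ≤ n → rhsCoeff (suc n) ℓ j ⊗ fromℕ ((ℓ ∸ j) C a) ≡
         (fromℕ (ℓ C a) ⊗ fromℕ (n !)) ⊗ (fromℕ ((ℓ ∸ a) C j) ⊗ (ι (- + 2) ^ᶜ j ⊗ fromℕ ((n ∸ j + n) C n)))
  summand j j≤n = begin
    fromℕ (ℓ C j) ⊗ fromℕ (ratio (suc n) j) ⊗ ι (- + 2) ^ᶜ j ⊗ fromℕ ((ℓ ∸ j) C a)
      ≡⟨ separate (fromℕ (ℓ C j)) (fromℕ (ratio (suc n) j)) (ι (- + 2) ^ᶜ j) (fromℕ ((ℓ ∸ j) C a)) ⟩
    (fromℕ (ℓ C j) ⊗ fromℕ ((ℓ ∸ j) C a)) ⊗ (fromℕ (ratio (suc n) j) ⊗ ι (- + 2) ^ᶜ j)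
      ≡⟨ cong₂ (λ t u → t ⊗ (u ⊗ ι (- + 2) ^ᶜ j)) subsets ratio≡ ⟩
    (fromℕ (ℓ C a) ⊗ fromℕ ((ℓ ∸ a) C j)) ⊗ ((fromℕ ((n ∸ j + n) C n) ⊗ fromℕ (n !)) ⊗ ι (- + 2) ^ᶜ j)
      ≡⟨ merge (fromℕ (ℓ C a)) (fromℕ ((ℓ ∸ a) C j)) (fromℕ ((n ∸ j + n) C n)) (fromℕ (n !)) (ι (- + 2) ^ᶜ j) ⟩
    (fromℕ (ℓ C a) ⊗ fromℕ (n !)) ⊗ (fromℕ ((ℓ ∸ a) C j) ⊗ (ι (- + 2) ^ᶜ j ⊗ fromℕ ((n ∸ j + n) C n))) ∎
    where
    open ≡-Reasoning
    separate : ∀ c r t b → c ⊗ r ⊗ t ⊗ b ≡ (c ⊗ b) ⊗ (r ⊗ t)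
    separate = solve-∀ ℤ[i]-ring
    merge : ∀ x y v f t → (x ⊗ y) ⊗ ((v ⊗ f) ⊗ t) ≡ (x ⊗ f) ⊗ (y ⊗ (t ⊗ v))
    merge = solve-∀ ℤ[i]-ring
    subsets : fromℕ (ℓ C j) ⊗ fromℕ ((ℓ ∸ j) C a) ≡ fromℕ (ℓ C a) ⊗ fromℕ ((ℓ ∸ a) C j)
    subsets = trans (sym (fromℕ-* (ℓ C j) ((ℓ ∸ j) C a)))
                    (trans (cong fromℕ (nCj*[n∸j]Ck≡nCk*[n∸k]Cj ℓ j a)) (fromℕ-* (ℓ C a) ((ℓ ∸ a) C j)))
    ratio≡ : fromℕ (ratio (suc n) j) ≡ fromℕ ((n ∸ j + n) C n) ⊗ fromℕ (n !)
    ratio≡ = trans (cong fromℕ (trans (ratio≡[n∸j+n]P′n n j j≤n) (sym (nCk*k!≡nP′k (n ∸ j + n) n))))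
                   (fromℕ-* ((n ∸ j + n) C n) (n !))

G-pascalᵐ : ∀ N r m → G (suc N) r (suc m) ≡ G (suc N) r m ⊕ ι (- + 2) ⊗ G N r m
G-pascalᵐ N r m = begin
  h 0 ⊕ ∑[ j < suc N ] (fromℕ (suc m C suc j) ⊗ (ι (- + 2) ^ᶜ suc j ⊗ B j))
    ≡⟨ cong (h 0 ⊕_) (∑-cong (suc N) (λ j _ → trans (cong (λ t → fromℕ t ⊗ (ι (- + 2) ^ᶜ suc j ⊗ B j)) (sym (nCk+nC[k+1]≡[n+1]C[k+1] m j)))
                                                    (split (fromℕ (m C j)) (fromℕ (m C suc j)) (ι (- + 2)) (ι (- + 2) ^ᶜ j) (B j)))) ⟩
  h 0 ⊕ ∑[ j < suc N ] (ι (- + 2) ⊗ g j ⊕ h (suc j))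
    ≡⟨ cong (h 0 ⊕_) (∑-⊕ (suc N) (λ j → ι (- + 2) ⊗ g j) (h ∘ suc)) ⟩
  h 0 ⊕ (∑[ j < suc N ] (ι (- + 2) ⊗ g j) ⊕ ∑ (suc N) (h ∘ suc))
    ≡⟨ cong (λ t → h 0 ⊕ (t ⊕ ∑ (suc N) (h ∘ suc))) (sym (⊗-distribˡ-∑ (suc N) (ι (- + 2)) g)) ⟩
  h 0 ⊕ (ι (- + 2) ⊗ G N r m ⊕ ∑ (suc N) (h ∘ suc))
    ≡⟨ rotate (h 0) (ι (- + 2) ⊗ G N r m) (∑ (suc N) (h ∘ suc)) ⟩
  G (suc N) r m ⊕ ι (- + 2) ⊗ G N r m ∎
  where
  open ≡-Reasoning
  B : ℕ → ℤ[i]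
  B j = fromℕ ((N ∸ j + r) C r)
  g h : ℕ → ℤ[i]
  g j = fromℕ (m C j) ⊗ (ι (- + 2) ^ᶜ j ⊗ B j)
  h j = fromℕ (m C j) ⊗ (ι (- + 2) ^ᶜ j ⊗ fromℕ ((suc N ∸ j + r) C r))
  split : ∀ x y t p b → (x ⊕ y) ⊗ ((t ⊗ p) ⊗ b) ≡ t ⊗ (x ⊗ (p ⊗ b)) ⊕ y ⊗ ((t ⊗ p) ⊗ b)
  split = solve-∀ ℤ[i]-ring
  rotate : ∀ a b c → a ⊕ (b ⊕ c) ≡ (a ⊕ c) ⊕ b
  rotate = solve-∀ ℤ[i]-ring

G-pascalʳ : ∀ N r m → G (suc N) (suc r) m ≡ G (suc N) r m ⊕ G N (suc r) m
G-pascalʳ N r m = begin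
  G (suc N) (suc r) m
    ≡⟨ ∑-init-last (suc N) L ⟩
  ∑ (suc N) L ⊕ L (suc N)
    ≡⟨ cong₂ _⊕_ (trans (∑-cong (suc N) (λ j j<1+N → L≡M⊕H j (≤-pred j<1+N))) (∑-⊕ (suc N) M H)) L≡M-last ⟩
  (∑ (suc N) M ⊕ ∑ (suc N) H) ⊕ M (suc N)
    ≡⟨ rotate (∑ (suc N) M) (∑ (suc N) H) (M (suc N)) ⟩
  (∑ (suc N) M ⊕ M (suc N)) ⊕ ∑ (suc N) H
    ≡⟨ cong (_⊕ ∑ (suc N) H) (sym (∑-init-last (suc N) M)) ⟩
  G (suc N) r m ⊕ G N (suc r) m ∎
  where
  open ≡-Reasoning
  L M H : ℕ → ℤ[i]
  L j = fromℕ (m C j) ⊗ (ι (- + 2) ^ᶜ j ⊗ fromℕ ((suc N ∸ j + suc r) C suc r))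
  M j = fromℕ (m C j) ⊗ (ι (- + 2) ^ᶜ j ⊗ fromℕ ((suc N ∸ j + r) C r))
  H j = fromℕ (m C j) ⊗ (ι (- + 2) ^ᶜ j ⊗ fromℕ ((N ∸ j + suc r) C suc r))
  rotate : ∀ a b c → (a ⊕ b) ⊕ c ≡ (a ⊕ c) ⊕ b
  rotate = solve-∀ ℤ[i]-ring
  L≡M-last : L (suc N) ≡ M (suc N)
  L≡M-last rewrite n∸n≡0 N | nCn≡1 (suc r) | nCn≡1 r = refl
  L≡M⊕H : ∀ j → j ≤ N → L j ≡ M j ⊕ H j
  L≡M⊕H j j≤N = begin
    fromℕ (m C j) ⊗ (ι (- + 2) ^ᶜ j ⊗ fromℕ ((suc N ∸ j + suc r) C suc r))
      ≡⟨ cong (λ t → fromℕ (m C j) ⊗ (ι (- + 2) ^ᶜ j ⊗ fromℕ ((t + suc r) C suc r))) (+-∸-assoc 1 j≤N) ⟩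
    fromℕ (m C j) ⊗ (ι (- + 2) ^ᶜ j ⊗ fromℕ (suc Y C suc r))
      ≡⟨ cong (λ t → fromℕ (m C j) ⊗ (ι (- + 2) ^ᶜ j ⊗ fromℕ t)) (sym (nCk+nC[k+1]≡[n+1]C[k+1] Y r)) ⟩
    fromℕ (m C j) ⊗ (ι (- + 2) ^ᶜ j ⊗ (fromℕ (Y C r) ⊕ fromℕ (Y C suc r)))
      ≡⟨ distrib (fromℕ (m C j)) (ι (- + 2) ^ᶜ j) (fromℕ (Y C r)) (fromℕ (Y C suc r)) ⟩
    fromℕ (m C j) ⊗ (ι (- + 2) ^ᶜ j ⊗ fromℕ (Y C r)) ⊕ H j
      ≡⟨ cong (λ t → fromℕ (m C j) ⊗ (ι (- + 2) ^ᶜ j ⊗ fromℕ (t C r)) ⊕ H j)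
              (trans (+-suc (N ∸ j) r) (cong (_+ r) (sym (+-∸-assoc 1 j≤N)))) ⟩
    M j ⊕ H j ∎
    where
    Y = N ∸ j + suc r
    distrib : ∀ c t x y → c ⊗ (t ⊗ (x ⊕ y)) ≡ c ⊗ (t ⊗ x) ⊕ c ⊗ (t ⊗ y)
    distrib = solve-∀ ℤ[i]-ring

G-zeroᴺ : ∀ r m → G 0 r m ≡ 𝟙
G-zeroᴺ r m rewrite nCn≡1 r = refl

G-zeroᵐ : ∀ N r → G N r 0 ≡ fromℕ ((N + r) C r)
G-zeroᵐ N r = trans (cong (fromℕ 1 ⊗ (𝟙 ⊗ fromℕ ((N + r) C r)) ⊕_) (∑-zero N (λ j _ → 𝟘-⊗ (rest j))))
                    (first (fromℕ ((N + r) C r)))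
  where
  rest : ℕ → ℤ[i]
  rest j = ι (- + 2) ^ᶜ suc j ⊗ fromℕ ((N ∸ suc j + r) C r)
  𝟘-⊗ : ∀ x → 𝟘 ⊗ x ≡ 𝟘
  𝟘-⊗ = solve-∀ ℤ[i]-ring
  first : ∀ x → fromℕ 1 ⊗ (𝟙 ⊗ x) ⊕ 𝟘 ≡ x
  first = solve-∀ ℤ[i]-ring

G-step : ∀ n m → G (suc n) (suc n) (suc (suc m)) ≡ G (suc n) (suc n) m ⊕ ι (- + 4) ⊗ G n n m
G-step zero m = begin
  G 1 1 (suc (suc m))
    ≡⟨ G-pascalᵐ 0 1 (suc m) ⟩
  G 1 1 (suc m) ⊕ ι (- + 2) ⊗ G 0 1 (suc m)
    ≡⟨ cong₂ (λ t u → t ⊕ ι (- + 2) ⊗ u) (G-pascalᵐ 0 1 m) (G-zeroᴺ 1 (suc m)) ⟩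
  (G 1 1 m ⊕ ι (- + 2) ⊗ G 0 1 m) ⊕ ι (- + 2) ⊗ 𝟙
    ≡⟨ cong (λ t → (G 1 1 m ⊕ ι (- + 2) ⊗ t) ⊕ ι (- + 2) ⊗ 𝟙) (G-zeroᴺ 1 m) ⟩
  (G 1 1 m ⊕ ι (- + 2) ⊗ 𝟙) ⊕ ι (- + 2) ⊗ 𝟙
    ≡⟨ collect (G 1 1 m) ⟩
  G 1 1 m ⊕ ι (- + 4) ⊗ 𝟙
    ≡⟨ cong (λ t → G 1 1 m ⊕ ι (- + 4) ⊗ t) (sym (G-zeroᴺ 0 m)) ⟩
  G 1 1 m ⊕ ι (- + 4) ⊗ G 0 0 m ∎
  where
  open ≡-Reasoning
  collect : ∀ x → (x ⊕ ι (- + 2) ⊗ 𝟙) ⊕ ι (- + 2) ⊗ 𝟙 ≡ x ⊕ ι (- + 4) ⊗ 𝟙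
  collect = solve-∀ ℤ[i]-ring
G-step (suc n) m = begin
  A₂
    ≡⟨ G-pascalᵐ (suc n) r (suc m) ⟩
  A₁ ⊕ ι (- + 2) ⊗ G (suc n) r (suc m)
    ≡⟨ cong₂ (λ t u → t ⊕ ι (- + 2) ⊗ u) (G-pascalᵐ (suc n) r m) (G-pascalᵐ n r m) ⟩
  (A₀ ⊕ ι (- + 2) ⊗ B₀) ⊕ ι (- + 2) ⊗ (B₀ ⊕ ι (- + 2) ⊗ C₀)
    ≡⟨ cong (λ t → (A₀ ⊕ ι (- + 2) ⊗ t) ⊕ ι (- + 2) ⊗ (t ⊕ ι (- + 2) ⊗ C₀)) (G-pascalʳ n (suc n) m) ⟩
  (A₀ ⊕ ι (- + 2) ⊗ (D₀ ⊕ C₀)) ⊕ ι (- + 2) ⊗ ((D₀ ⊕ C₀) ⊕ ι (- + 2) ⊗ C₀)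
    ≡⟨ collect A₀ C₀ D₀ ⟩
  A₀ ⊕ ι (- + 4) ⊗ D₀ ∎
  where
  open ≡-Reasoning
  r  = suc (suc n)
  A₂ = G (suc (suc n)) r (suc (suc m))
  A₁ = G (suc (suc n)) r (suc m)
  A₀ = G (suc (suc n)) r m
  B₀ = G (suc n) r m
  C₀ = G n r m
  D₀ = G (suc n) (suc n) m
  collect : ∀ A₀ C₀ D₀ →
    (A₀ ⊕ ι (- + 2) ⊗ (D₀ ⊕ C₀)) ⊕ ι (- + 2) ⊗ ((D₀ ⊕ C₀) ⊕ ι (- + 2) ⊗ C₀) ≡ A₀ ⊕ ι (- + 4) ⊗ D₀
  collect = solve-∀ ℤ[i]-ring

-- C(2n+2, n+1) = 2 C(2n+1, n+1) by Pascal and symmetry.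
G-one : ∀ n → G (suc n) (suc n) 1 ≡ 𝟘
G-one n = begin
  G (suc n) (suc n) 1
    ≡⟨ G-pascalᵐ n (suc n) 0 ⟩
  G (suc n) (suc n) 0 ⊕ ι (- + 2) ⊗ G n (suc n) 0
    ≡⟨ cong₂ (λ t u → t ⊕ ι (- + 2) ⊗ u) (G-zeroᵐ (suc n) (suc n)) (G-zeroᵐ n (suc n)) ⟩
  fromℕ (suc X C suc n) ⊕ ι (- + 2) ⊗ Y
    ≡⟨ cong (λ t → fromℕ t ⊕ ι (- + 2) ⊗ Y) (sym (nCk+nC[k+1]≡[n+1]C[k+1] X n)) ⟩
  (fromℕ (X C n) ⊕ Y) ⊕ ι (- + 2) ⊗ Y
    ≡⟨ cong (λ t → (fromℕ t ⊕ Y) ⊕ ι (- + 2) ⊗ Y) symmetric ⟩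
  (Y ⊕ Y) ⊕ ι (- + 2) ⊗ Y
    ≡⟨ cancel Y ⟩
  𝟘 ∎
  where
  open ≡-Reasoning
  X = n + suc n
  Y = fromℕ (X C suc n)
  symmetric : X C n ≡ X C suc n
  symmetric = trans (nCk≡nC[n∸k] (m≤m+n n (suc n))) (cong (X C_) (m+n∸m≡n n (suc n)))
  cancel : ∀ y → (y ⊕ y) ⊕ ι (- + 2) ⊗ y ≡ 𝟘
  cancel = solve-∀ ℤ[i]-ring

G-odd : ∀ p n → G n n (suc (p + p)) ≡ fromℕ (p C n) ⊗ ι (- + 4) ^ᶜ n
G-odd zero    zero    = G-zeroᴺ 0 1
G-odd zero    (suc n) = trans (G-one n) (sym (𝟘-⊗ (ι (- + 4) ^ᶜ suc n)))
  where
  𝟘-⊗ : ∀ x → 𝟘 ⊗ x ≡ 𝟘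
  𝟘-⊗ = solve-∀ ℤ[i]-ring
G-odd (suc p) zero    = G-zeroᴺ 0 (suc (suc p + suc p))
G-odd (suc p) (suc n) = begin
  G (suc n) (suc n) (suc (suc p + suc p))
    ≡⟨ cong (λ t → G (suc n) (suc n) (suc (suc t))) (+-suc p p) ⟩
  G (suc n) (suc n) (suc (suc (suc (p + p))))
    ≡⟨ G-step n (suc (p + p)) ⟩
  G (suc n) (suc n) (suc (p + p)) ⊕ ι (- + 4) ⊗ G n n (suc (p + p))
    ≡⟨ cong₂ (λ t u → t ⊕ ι (- + 4) ⊗ u) (G-odd p (suc n)) (G-odd p n) ⟩
  fromℕ (p C suc n) ⊗ (ι (- + 4) ⊗ ι (- + 4) ^ᶜ n) ⊕ ι (- + 4) ⊗ (fromℕ (p C n) ⊗ ι (- + 4) ^ᶜ n)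
    ≡⟨ collect (fromℕ (p C suc n)) (fromℕ (p C n)) (ι (- + 4) ^ᶜ n) ⟩
  (fromℕ (p C n) ⊕ fromℕ (p C suc n)) ⊗ (ι (- + 4) ⊗ ι (- + 4) ^ᶜ n)
    ≡⟨ cong (λ t → fromℕ t ⊗ ι (- + 4) ^ᶜ suc n) (nCk+nC[k+1]≡[n+1]C[k+1] p n) ⟩
  fromℕ (suc p C suc n) ⊗ ι (- + 4) ^ᶜ suc n ∎
  where
  open ≡-Reasoning
  collect : ∀ a b x → a ⊗ (ι (- + 4) ⊗ x) ⊕ ι (- + 4) ⊗ (b ⊗ x) ≡ (b ⊕ a) ⊗ (ι (- + 4) ⊗ x)
  collect = solve-∀ ℤ[i]-ring

2*[1+n]∸1≡1+2n : ∀ n → 2 * suc n ∸ 1 ≡ suc (n + n)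
2*[1+n]∸1≡1+2n n = cong (_∸ 1) (2*[1+n]≡2+2n n)

flag⇒ℓ≡1+2n : ∀ n ℓ → (ℓ ≡ᵇ (2 * suc n ∸ 1)) ≡ true → ℓ ≡ suc (n + n)
flag⇒ℓ≡1+2n n ℓ flag = trans (≡ᵇ⇒≡ ℓ (2 * suc n ∸ 1) (Equivalence.from T-≡ flag)) (2*[1+n]∸1≡1+2n n)

evenPart : ℕ → ℕ → ℕ → Profile
evenPart n ℓ j a = if even (ℓ ∸ a) then fromℕ ((ℓ ∸ j) C a) ⊗ (ι (- + 1) ^ᶜ n ⊗ 𝕚 ^ᶜ (ℓ ∸ a)) else 𝟘

correction : ℕ → ℤ[i]
correction n = 𝕚 ⊗ ι (- + 1) ^ᶜ n ⊗ ι (+ (2 ^ (2 * suc n ∸ 2))) ⊗ ι (+ (n !))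

correctionᵖ : ℕ → ℕ → Profile
correctionᵖ n ℓ a = if ℓ ≡ᵇ (2 * suc n ∸ 1) then ⟦ 0 ≟ a ⟧ ⊗ correction n else 𝟘

rhsᵖ : ℕ → ℕ → Profile
rhsᵖ n ℓ a = ∑[ j < suc (n ⊓ ℓ) ] (rhsCoeff (suc n) ℓ j ⊗ evenPart n ℓ j a) ⊕ correctionᵖ n ℓ a

evenTerm-homogeneous : ∀ n ℓ j α → α ≤ ℓ →
  (if even (ℓ ∸ α) then ι (+ ((ℓ ∸ j) C α)) · term (suc n) ℓ α else zeroFn) ≋
  homogeneous (+ ℓ ℤ.- + n) (λ a → ⟦ α ≟ a ⟧ ⊗ evenPart n ℓ j α)
evenTerm-homogeneous n ℓ j α α≤ℓ a b with even (ℓ ∸ α)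
... | true  = begin
  fromℕ ((ℓ ∸ j) C α) ⊗ (σ𝕚 · mono 𝟙 α B) a b
    ≡⟨ ·-cong (fromℕ ((ℓ ∸ j) C α)) (·-mono-homogeneous σ𝕚 α B (+ ℓ ℤ.- + n) degree) a b ⟩
  fromℕ ((ℓ ∸ j) C α) ⊗ (D ⊗ (⟦ α ≟ a ⟧ ⊗ σ𝕚))
    ≡⟨ regroup (fromℕ ((ℓ ∸ j) C α)) D ⟦ α ≟ a ⟧ σ𝕚 ⟩
  D ⊗ (⟦ α ≟ a ⟧ ⊗ (fromℕ ((ℓ ∸ j) C α) ⊗ σ𝕚)) ∎
  where
  open ≡-Reasoning
  σ𝕚 = ι (- + 1) ^ᶜ n ⊗ 𝕚 ^ᶜ (ℓ ∸ α)
  B  = + (ℓ ∸ α) ℤ.+ + 1 ℤ.- + suc n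
  D  = ⟦ + ℓ ℤ.- + n ℤ.- + a ℤ.≟ b ⟧
  degree : + α ℤ.+ B ≡ + ℓ ℤ.- + n
  degree = trans (shift (+ α) (+ (ℓ ∸ α)) (+ n)) (cong (λ t → + t ℤ.- + n) (m+[n∸m]≡n α≤ℓ))
    where
    shift : ∀ x y n → x ℤ.+ (y ℤ.+ + 1 ℤ.- (+ 1 ℤ.+ n)) ≡ x ℤ.+ y ℤ.- n
    shift = ℤ-solve-∀
  regroup : ∀ c d e s → c ⊗ (d ⊗ (e ⊗ s)) ≡ d ⊗ (e ⊗ (c ⊗ s))
  regroup = solve-∀ ℤ[i]-ring
... | false = trans (zeroFn-homogeneous (+ ℓ ℤ.- + n) a b) (cong (⟦ + ℓ ℤ.- + n ℤ.- + a ℤ.≟ b ⟧ ⊗_) (sym (⊗-zeroʳ ⟦ α ≟ a ⟧)))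
  where
  ⊗-zeroʳ : ∀ x → x ⊗ 𝟘 ≡ 𝟘
  ⊗-zeroʳ = solve-∀ ℤ[i]-ring

evenSum-homogeneous : ∀ n ℓ j →
  Σto (ℓ ∸ j) (λ α → if even (ℓ ∸ α) then ι (+ ((ℓ ∸ j) C α)) · term (suc n) ℓ α else zeroFn) ≋
  homogeneous (+ ℓ ℤ.- + n) (evenPart n ℓ j)
evenSum-homogeneous n ℓ j a b =
  trans (Σto-homogeneous (ℓ ∸ j) (+ ℓ ℤ.- + n) _ (λ α a → ⟦ α ≟ a ⟧ ⊗ evenPart n ℓ j α)
                         (λ α α≤ℓ∸j → evenTerm-homogeneous n ℓ j α (≤-trans α≤ℓ∸j (m∸n≤m ℓ j))) a b)
        (cong (⟦ + ℓ ℤ.- + n ℤ.- + a ℤ.≟ b ⟧ ⊗_) (∑-⟦≟⟧ (suc (ℓ ∸ j)) a (evenPart n ℓ j) outside))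
  where
  outside : suc (ℓ ∸ j) ≤ a → evenPart n ℓ j a ≡ 𝟘
  outside ℓ∸j<a with even (ℓ ∸ a)
  ... | true  rewrite k>n⇒nCk≡0 ℓ∸j<a = 𝟘-⊗ (ι (- + 1) ^ᶜ n ⊗ 𝕚 ^ᶜ (ℓ ∸ a))
    where
    𝟘-⊗ : ∀ x → 𝟘 ⊗ x ≡ 𝟘
    𝟘-⊗ = solve-∀ ℤ[i]-ring
  ... | false = refl

correction-homogeneous : ∀ n ℓ →
  (if ℓ ≡ᵇ (2 * suc n ∸ 1) then correction n · mono 𝟙 0 (+ suc n) else zeroFn) ≋
  homogeneous (+ ℓ ℤ.- + n) (correctionᵖ n ℓ)
correction-homogeneous n ℓ with ℓ ≡ᵇ (2 * suc n ∸ 1) in flag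
... | true  = ·-mono-homogeneous (correction n) 0 (+ suc n) (+ ℓ ℤ.- + n) degree
  where
  degree : + 0 ℤ.+ + suc n ≡ + ℓ ℤ.- + n
  degree = sym (trans (cong (λ t → + t ℤ.- + n) (flag⇒ℓ≡1+2n n ℓ flag)) (cancel (+ n)))
    where
    cancel : ∀ n → + 1 ℤ.+ (n ℤ.+ n) ℤ.- n ≡ + 1 ℤ.+ n
    cancel = ℤ-solve-∀
... | false = zeroFn-homogeneous (+ ℓ ℤ.- + n)

rhs-homogeneous : ∀ n ℓ → rhs (suc n) ℓ ≋ homogeneous (+ ℓ ℤ.- + n) (rhsᵖ n ℓ)
rhs-homogeneous n ℓ = begin
  rhs (suc n) ℓ
    ≈⟨ ⊞-cong (Σto-homogeneous (n ⊓ ℓ) (+ ℓ ℤ.- + n) _ (λ j a → rhsCoeff (suc n) ℓ j ⊗ evenPart n ℓ j a)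
                                 (λ j _ a b → trans (·-cong (rhsCoeff (suc n) ℓ j) (evenSum-homogeneous n ℓ j) a b)
                                                    (·-homogeneous (rhsCoeff (suc n) ℓ j) (+ ℓ ℤ.- + n) (evenPart n ℓ j) a b)))
              (correction-homogeneous n ℓ) ⟩
  homogeneous (+ ℓ ℤ.- + n) (λ a → ∑[ j < suc (n ⊓ ℓ) ] (rhsCoeff (suc n) ℓ j ⊗ evenPart n ℓ j a))
    ⊞ homogeneous (+ ℓ ℤ.- + n) (correctionᵖ n ℓ)
    ≈⟨ ⊞-homogeneous (+ ℓ ℤ.- + n) (λ a → ∑[ j < suc (n ⊓ ℓ) ] (rhsCoeff (suc n) ℓ j ⊗ evenPart n ℓ j a)) (correctionᵖ n ℓ) ⟩
  homogeneous (+ ℓ ℤ.- + n) (rhsᵖ n ℓ) ∎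
  where open SetoidReasoning ≋-setoid

1+2n-odd : ∀ n → even (suc (n + n)) ≡ false
1+2n-odd zero    = refl
1+2n-odd (suc n) = trans (cong (λ t → even (suc (suc t))) (+-suc n n)) (1+2n-odd n)

odd⇒1+2p : ∀ m → even m ≡ false → ∃ λ p → m ≡ suc (p + p)
odd⇒1+2p (suc zero)    _   = 0 , refl
odd⇒1+2p (suc (suc m)) odd with odd⇒1+2p m odd
... | p , refl = suc p , cong (suc ∘ suc) (sym (+-suc p p))

rhsCoeff-vanish : ∀ n ℓ j → ℓ < j → rhsCoeff (suc n) ℓ j ≡ 𝟘
rhsCoeff-vanish n ℓ j ℓ<j rewrite k>n⇒nCk≡0 ℓ<j = 𝟘-⊗ (fromℕ (ratio (suc n) j)) (ι (- + 2) ^ᶜ j)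
  where
  𝟘-⊗ : ∀ x y → 𝟘 ⊗ x ⊗ y ≡ 𝟘
  𝟘-⊗ = solve-∀ ℤ[i]-ring

∑rhsCoeff-⊓ : ∀ n ℓ (x : ℕ → ℤ[i]) →
  ∑[ j < suc (n ⊓ ℓ) ] (rhsCoeff (suc n) ℓ j ⊗ x j) ≡ ∑[ j < suc n ] (rhsCoeff (suc n) ℓ j ⊗ x j)
∑rhsCoeff-⊓ n ℓ x = sym (∑-truncate (suc (n ⊓ ℓ)) (suc n) (λ j → rhsCoeff (suc n) ℓ j ⊗ x j) (s≤s (m⊓n≤m n ℓ)) vanish)
  where
  vanish : ∀ j → suc (n ⊓ ℓ) ≤ j → j < suc n → rhsCoeff (suc n) ℓ j ⊗ x j ≡ 𝟘
  vanish j n⊓ℓ<j j<1+n =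
    trans (cong (_⊗ x j) (rhsCoeff-vanish n ℓ j (≰⇒> (λ j≤ℓ → <⇒≱ n⊓ℓ<j (⊓-glb (≤-pred j<1+n) j≤ℓ))))) (𝟘-⊗ (x j))
    where
    𝟘-⊗ : ∀ x → 𝟘 ⊗ x ≡ 𝟘
    𝟘-⊗ = solve-∀ ℤ[i]-ring

correctionᵖ-absent : ∀ n ℓ a → (ℓ ≡ suc (n + n) → a ≡ 0 → ⊥) → correctionᵖ n ℓ a ≡ 𝟘
correctionᵖ-absent n ℓ a not-top with ℓ ≡ᵇ (2 * suc n ∸ 1) in flag | a
... | true  | zero  = ⊥-elim (not-top (flag⇒ℓ≡1+2n n ℓ flag) refl)
... | true  | suc _ = 𝟘-⊗ (correction n)
  where
  𝟘-⊗ : ∀ x → 𝟘 ⊗ x ≡ 𝟘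
  𝟘-⊗ = solve-∀ ℤ[i]-ring
... | false | _     = refl

evenPart-even : ∀ n ℓ j a → even (ℓ ∸ a) ≡ true → evenPart n ℓ j a ≡ fromℕ ((ℓ ∸ j) C a) ⊗ (ι (- + 1) ^ᶜ n ⊗ 𝕚 ^ᶜ (ℓ ∸ a))
evenPart-even n ℓ j a parity rewrite parity = refl

evenPart-odd : ∀ n ℓ j a → even (ℓ ∸ a) ≡ false → evenPart n ℓ j a ≡ 𝟘
evenPart-odd n ℓ j a parity rewrite parity = refl

i^[2n]⊗[-4]^n≡2^[2n] : ∀ n → 𝕚 ^ᶜ (n + n) ⊗ ι (- + 4) ^ᶜ n ≡ fromℕ (2 ^ (2 * suc n ∸ 2))
i^[2n]⊗[-4]^n≡2^[2n] n = begin
  𝕚 ^ᶜ (n + n) ⊗ ι (- + 4) ^ᶜ n          ≡⟨ cong (_⊗ ι (- + 4) ^ᶜ n) (trans (^ᶜ-+ 𝕚 n n) (sym (^ᶜ-distribʳ-⊗ 𝕚 𝕚 n))) ⟩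
  (𝕚 ⊗ 𝕚) ^ᶜ n ⊗ ι (- + 4) ^ᶜ n          ≡⟨ sym (^ᶜ-distribʳ-⊗ (𝕚 ⊗ 𝕚) (ι (- + 4)) n) ⟩
  (fromℕ 2 ⊗ fromℕ 2) ^ᶜ n               ≡⟨ ^ᶜ-distribʳ-⊗ (fromℕ 2) (fromℕ 2) n ⟩
  fromℕ 2 ^ᶜ n ⊗ fromℕ 2 ^ᶜ n            ≡⟨ sym (^ᶜ-+ (fromℕ 2) n n) ⟩
  fromℕ 2 ^ᶜ (n + n)                     ≡⟨ sym (fromℕ-^ 2 (n + n)) ⟩
  fromℕ (2 ^ (n + n))                    ≡⟨ cong (λ t → fromℕ (2 ^ (t ∸ 2))) (sym (2*[1+n]≡2+2n n)) ⟩
  fromℕ (2 ^ (2 * suc n ∸ 2))            ∎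
  where
  open ≡-Reasoning

top-coefficient : ∀ n →
  (ι (- + 1) ^ᶜ n ⊗ 𝕚 ^ᶜ suc (n + n)) ⊗ ((fromℕ (suc (n + n) C 0) ⊗ fromℕ (n !)) ⊗ (fromℕ (n C n) ⊗ ι (- + 4) ^ᶜ n))
    ≡ correctionᵖ n (suc (n + n)) 0
top-coefficient n rewrite nCn≡1 n | Equivalence.to T-≡ (≡⇒≡ᵇ (suc (n + n)) (2 * suc n ∸ 1) (sym (2*[1+n]∸1≡1+2n n))) = begin
  (σⁿ ⊗ (𝕚 ⊗ 𝕚 ^ᶜ (n + n))) ⊗ ((fromℕ 1 ⊗ fromℕ (n !)) ⊗ (fromℕ 1 ⊗ ι (- + 4) ^ᶜ n))
    ≡⟨ regroup σⁿ (𝕚 ^ᶜ (n + n)) (ι (- + 4) ^ᶜ n) (fromℕ (n !)) ⟩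
  𝟙 ⊗ (𝕚 ⊗ σⁿ ⊗ (𝕚 ^ᶜ (n + n) ⊗ ι (- + 4) ^ᶜ n) ⊗ fromℕ (n !))
    ≡⟨ cong (λ t → 𝟙 ⊗ (𝕚 ⊗ σⁿ ⊗ t ⊗ fromℕ (n !))) (i^[2n]⊗[-4]^n≡2^[2n] n) ⟩
  𝟙 ⊗ correction n ∎
  where
  open ≡-Reasoning
  σⁿ = ι (- + 1) ^ᶜ n
  regroup : ∀ s z w f → (s ⊗ (𝕚 ⊗ z)) ⊗ ((fromℕ 1 ⊗ f) ⊗ (fromℕ 1 ⊗ w)) ≡ 𝟙 ⊗ (𝕚 ⊗ s ⊗ (z ⊗ w) ⊗ f)
  regroup = solve-∀ ℤ[i]-ring

-- C(p, n) = 0 kills the odd part unless p = n, which forces ℓ = 2n + 1 and a = 0.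
odd-coefficient : ∀ n ℓ a p → ℓ ≤ suc (n + n) → ℓ ∸ a ≡ suc (p + p) →
  (ι (- + 1) ^ᶜ n ⊗ 𝕚 ^ᶜ (ℓ ∸ a)) ⊗ ((fromℕ (ℓ C a) ⊗ fromℕ (n !)) ⊗ (fromℕ (p C n) ⊗ ι (- + 4) ^ᶜ n)) ≡ correctionᵖ n ℓ a
odd-coefficient n ℓ a p ℓ≤1+2n ℓ∸a≡1+2p with p <? n
... | yes p<n rewrite k>n⇒nCk≡0 p<n =
  trans (vanish (ι (- + 1) ^ᶜ n ⊗ 𝕚 ^ᶜ (ℓ ∸ a)) (fromℕ (ℓ C a) ⊗ fromℕ (n !)) (ι (- + 4) ^ᶜ n))
        (sym (correctionᵖ-absent n ℓ a not-top))
  where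
  vanish : ∀ s c w → s ⊗ (c ⊗ (𝟘 ⊗ w)) ≡ 𝟘
  vanish = solve-∀ ℤ[i]-ring
  not-top : ℓ ≡ suc (n + n) → a ≡ 0 → ⊥
  not-top refl refl = <-irrefl (suc-injective (sym ℓ∸a≡1+2p)) (+-mono-< p<n p<n)
... | no p≮n with ≤-antisym p≤n (≮⇒≥ p≮n)
  where
  p≤n : p ≤ n
  p≤n = ≮⇒≥ (λ n<p → <⇒≱ (+-mono-< n<p n<p) (≤-pred (≤-trans (≤-reflexive (sym ℓ∸a≡1+2p)) (≤-trans (m∸n≤m ℓ a) ℓ≤1+2n))))
...   | refl with ≤-antisym ℓ≤1+2n (≤-trans (≤-reflexive (sym ℓ∸a≡1+2p)) (m∸n≤m ℓ a))
...     | refl with a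
...       | zero  = top-coefficient p
...       | suc a′ = ⊥-elim (<-irrefl ℓ∸a≡1+2p (s≤s (m∸n≤m (p + p) a′)))

even-profile : ∀ n ℓ a → even (ℓ ∸ a) ≡ true →
  (ι (- + 1) ^ᶜ n ⊗ 𝕚 ^ᶜ (ℓ ∸ a)) ⊗ ∑[ j < suc n ] (rhsCoeff (suc n) ℓ j ⊗ fromℕ ((ℓ ∸ j) C a)) ≡ rhsᵖ n ℓ a
even-profile n ℓ a parity = begin
  P ⊗ ∑[ j < suc n ] (rhsCoeff (suc n) ℓ j ⊗ fromℕ ((ℓ ∸ j) C a))
    ≡⟨ ⊗-distribˡ-∑ (suc n) P (λ j → rhsCoeff (suc n) ℓ j ⊗ fromℕ ((ℓ ∸ j) C a)) ⟩
  ∑[ j < suc n ] (P ⊗ (rhsCoeff (suc n) ℓ j ⊗ fromℕ ((ℓ ∸ j) C a)))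
    ≡⟨ ∑-cong (suc n) (λ j _ → trans (swap P (rhsCoeff (suc n) ℓ j) (fromℕ ((ℓ ∸ j) C a)))
                                     (cong (rhsCoeff (suc n) ℓ j ⊗_) (sym (evenPart-even n ℓ j a parity)))) ⟩
  ∑[ j < suc n ] (rhsCoeff (suc n) ℓ j ⊗ evenPart n ℓ j a)
    ≡⟨ sym (∑rhsCoeff-⊓ n ℓ (λ j → evenPart n ℓ j a)) ⟩
  E
    ≡⟨ sym (⊕-identityʳ E) ⟩
  E ⊕ 𝟘
    ≡⟨ cong (E ⊕_) (sym (correctionᵖ-absent n ℓ a not-top)) ⟩
  E ⊕ correctionᵖ n ℓ a ∎
  where
  open ≡-Reasoning
  P = ι (- + 1) ^ᶜ n ⊗ 𝕚 ^ᶜ (ℓ ∸ a)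
  E = ∑[ j < suc (n ⊓ ℓ) ] (rhsCoeff (suc n) ℓ j ⊗ evenPart n ℓ j a)
  swap : ∀ p c b → p ⊗ (c ⊗ b) ≡ c ⊗ (b ⊗ p)
  swap = solve-∀ ℤ[i]-ring
  not-top : ℓ ≡ suc (n + n) → a ≡ 0 → ⊥
  not-top refl refl with () ← trans (sym parity) (1+2n-odd n)

odd-profile : ∀ n ℓ a → ℓ ≤ suc (n + n) → even (ℓ ∸ a) ≡ false →
  (ι (- + 1) ^ᶜ n ⊗ 𝕚 ^ᶜ (ℓ ∸ a)) ⊗ ∑[ j < suc n ] (rhsCoeff (suc n) ℓ j ⊗ fromℕ ((ℓ ∸ j) C a)) ≡ rhsᵖ n ℓ a
odd-profile n ℓ a ℓ≤1+2n parity with odd⇒1+2p (ℓ ∸ a) parity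
... | p , ℓ∸a≡1+2p = begin
  P ⊗ ∑[ j < suc n ] (rhsCoeff (suc n) ℓ j ⊗ fromℕ ((ℓ ∸ j) C a))
    ≡⟨ cong (P ⊗_) (∑rhsCoeff≡G n ℓ a) ⟩
  P ⊗ (F ⊗ G n n (ℓ ∸ a))
    ≡⟨ cong (λ t → P ⊗ (F ⊗ t)) (trans (cong (G n n) ℓ∸a≡1+2p) (G-odd p n)) ⟩
  P ⊗ (F ⊗ (fromℕ (p C n) ⊗ ι (- + 4) ^ᶜ n))
    ≡⟨ odd-coefficient n ℓ a p ℓ≤1+2n ℓ∸a≡1+2p ⟩
  correctionᵖ n ℓ a
    ≡⟨ sym (⊕-identityˡ (correctionᵖ n ℓ a)) ⟩
  𝟘 ⊕ correctionᵖ n ℓ a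
    ≡⟨ cong (_⊕ correctionᵖ n ℓ a) (sym (∑-zero (suc (n ⊓ ℓ)) (λ j _ → no-even-part j))) ⟩
  ∑[ j < suc (n ⊓ ℓ) ] (rhsCoeff (suc n) ℓ j ⊗ evenPart n ℓ j a) ⊕ correctionᵖ n ℓ a ∎
  where
  open ≡-Reasoning
  P = ι (- + 1) ^ᶜ n ⊗ 𝕚 ^ᶜ (ℓ ∸ a)
  F = fromℕ (ℓ C a) ⊗ fromℕ (n !)
  no-even-part : ∀ j → rhsCoeff (suc n) ℓ j ⊗ evenPart n ℓ j a ≡ 𝟘
  no-even-part j = trans (cong (rhsCoeff (suc n) ℓ j ⊗_) (evenPart-odd n ℓ j a parity)) (⊗-zeroʳ (rhsCoeff (suc n) ℓ j))
    where
    ⊗-zeroʳ : ∀ x → x ⊗ 𝟘 ≡ 𝟘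
    ⊗-zeroʳ = solve-∀ ℤ[i]-ring

profile-identity : ∀ n ℓ a → ℓ ≤ suc (n + n) →
  ∑[ i < suc n ] (ι (raisingCoeff n (+ 0 ℤ.+ κ₀ n) i) ⊗ Dτᵖ ℓ i a) ≡ rhsᵖ n ℓ a
profile-identity n ℓ a ℓ≤1+2n = trans (R^[k-1]τ^ᵖ n ℓ a) (by-parity (even (ℓ ∸ a)) refl)
  where
  by-parity : ∀ b → even (ℓ ∸ a) ≡ b →
    (ι (- + 1) ^ᶜ n ⊗ 𝕚 ^ᶜ (ℓ ∸ a)) ⊗ ∑[ j < suc n ] (rhsCoeff (suc n) ℓ j ⊗ fromℕ ((ℓ ∸ j) C a)) ≡ rhsᵖ n ℓ a
  by-parity true  = even-profile n ℓ a
  by-parity false = odd-profile n ℓ a ℓ≤1+2n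

lemma5p2 : (k ℓ : ℕ) → 1 ≤ k → ℓ ≤ 2 * k ∸ 1 → R^[k-1] k (τ^ ℓ) ≋ rhs k ℓ
lemma5p2 (suc n) ℓ _ ℓ≤2k-1 = begin
  R^[k-1] (suc n) (τ^ ℓ)
    ≈⟨ R^[k-1]τ^-homogeneous n ℓ ⟩
  homogeneous (+ ℓ ℤ.- + n) (λ a → ∑[ i < suc n ] (ι (raisingCoeff n (+ 0 ℤ.+ κ₀ n) i) ⊗ Dτᵖ ℓ i a))
    ≈⟨ homogeneous-cong {w = + ℓ ℤ.- + n} refl (λ a → profile-identity n ℓ a (subst (ℓ ≤_) (2*[1+n]∸1≡1+2n n) ℓ≤2k-1)) ⟩
  homogeneous (+ ℓ ℤ.- + n) (rhsᵖ n ℓ)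
    ≈⟨ Setoid.sym ≋-setoid (rhs-homogeneous n ℓ) ⟩
  rhs (suc n) ℓ ∎
  where open SetoidReasoning ≋-setoid
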